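{- Let $S\subseteq\omega$ be finite. Then $S$ is an envelope if and only if both of the following hold: (1) for any $m,n\in S$, we have $\ell(c(m)\wedge c(n))\in S$; (2) for every $m\le\max(S)$ with $m\notin S$, the restriction map $\pi_m:c[S]|_{m+1}\to T(m)$ is an age map, where $c[S]|_{m+1}=\{c(a)|_{m+1}: a\in S\setminus(m+1)\}$ (carrying the restriction of $\mathcal C(m+1)$) and $T(m)$ carries $\mathcal C(m)$.
   Context: Conventions. $\mathcal L=\{U_0,\dots,U_{k-1};R_0,\dots,R_{k-1}\}$ is a finite relational language, $U_i$ unary, $R_i$ binary, and all $\mathcal L$-structures $\mathbf A$ satisfy: every $R_i^{\mathbf A}$ is irreflexive; $\mathbf A=\bigsqcup_{i<k}U_i^{\mathbf A}$; $\mathbf A^2\setminus\{(a,a):a\in\mathbf A\}=\bigsqcup_{i<k}R_i^{\mathbf A}$; and there is $\mathrm{Flip}:k\to k$ with $\mathrm{Flip}^2=\mathrm{id}$, $\mathrm{Flip}(0)=0$, such that $R^{\mathbf A}(a,b)=i$ iff $R^{\mathbf A}(b,a)=\mathrm{Flip}(i)$. Here $U^{\mathbf A}(a)=i$ means $U_i^{\mathbf A}(a)$ and $R^{\mathbf A}(a,b)=i$ means $R_i^{\mathbf A}(a,b)$; $R_0$ plays the role of "no relation". $\mathcal K$ is a Fraïssé class of finite $\mathcal L$-structures with free amalgamation: any embeddings $f:\mathbf A\to\mathbf B$, $g:\mathbf A\to\mathbf C$ in $\mathcal K$ can be amalgamated by embeddings $r:\mathbf B\to\mathbf D$, $s:\mathbf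 C\to\mathbf D$ with $\mathbf D\in\mathcal K$, $r\circ f=s\circ g$, $\mathbf D=\mathrm{im}(r)\cup\mathrm{im}(s)$, $\mathrm{im}(r)\cap\mathrm{im}(s)=\mathrm{im}(r\circ f)$, and $R^{\mathbf D}(a,b)=0$ unless $\{a,b\}\subseteq\mathrm{im}(r)$ or $\{a,b\}\subseteq\mathrm{im}(s)$. An enumerated structure is one whose underlying set is the cardinal $|\mathbf A|\le\omega$; for $m\le|\mathbf A|$, $\mathbf A_m$ is the induced substructure on $m=\{0,\dots,m-1\}$. $\mathbf K$ is a Fraïssé limit of $\mathcal K$ with underlying set $\omega$ which is left dense: for every $m<\omega$ and every $\mathbf A\in\mathcal K$ with underlying set $m+1$ and $\mathbf A_m=\mathbf K_m$ there is $n\ge m$ such that the map $i\mapsto i$ ($i<m$), $m\mapsto n$ is an embedding $\mathbf A\to\mathbf K$ and $R^{\mathbf K}(r,n)=0$ for all $m\le r<n$. Write $U=U^{\mathbf K}$, $R=R^{\mathbf K}$. $\mathrm{Age}(\mathbf A)$ is the class of finite structures embeddable in $\mathbf A$. Trees. $T=k^{<\omega}$, $T(n)=k^n$, with $T(<n),T(\ge n)$ as usual; $\ell(s)$ is the length of $s$; $s\sqsubseteq t$ means $t$ extends $s$; $s\wedge t$ is the longest common initial segment; $s^\frown i$ appends $i<k$; $s|_n$ is the restriction of $s$ to length $n$; $\pi_m:T(\ge m)\to T(m)$ is restriction. Coding trees. For enumerated $\mathbf A$, $\mathrm{ct}^{\mathbf A}=(c^{\mathbf A},u^{\mathbf A})$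 where $c^{\mathbf A}(j)\in T(j)$ is given by $c^{\mathbf A}(j)(i)=R^{\mathbf A}(i,j)$ for $i<j<|\mathbf A|$, and $u^{\mathbf A}(j)=U^{\mathbf A}(j)$. Write $\mathrm{ct}=(c,u)=\mathrm{ct}^{\mathbf K}$. Labeled structures. For a finite set $X$, an $X$-labeled structure is a finite $\mathcal L$-structure $\mathbf B$ with a map $\phi:\mathbf B\to X$. For enumerated $\mathbf A$, $m\le|\mathbf A|$, $m<\omega$, and a $T(m)$-labeled $(\mathbf B,\phi)$ with $\mathbf B\cap\omega=\emptyset$, $\mathbf B[\phi,\mathbf A]$ is the $\mathcal L$-structure on $\mathbf B\cup\mathbf A_m$ with $\mathbf B$ and $\mathbf A_m$ as induced substructures and $R(i,b)=\phi(b)(i)$ for $i<m$, $b\in\mathbf B$. If $\mathrm{Age}(\mathbf A)\subseteq\mathcal K$, $\mathcal C^{\mathbf A}(m)$ is the class of $T(m)$-labeled $(\mathbf B,\phi)$ with $\mathbf B[\phi,\mathbf A]\in\mathcal K$; $\mathcal C(m)=\mathcal C^{\mathbf K}(m)$; a subset $X\subseteq T(m)$ carries the class of $X$-labeled structures in $\mathcal C(m)$. Given finite sets $X,Y$ with classes $\mathcal C_X,\mathcal C_Y$ of $X$- resp. $Y$-labeled structures, an age map is an injection $f:X\to Y$ such that for every $X$-labeled $(\mathbf B,\phi)$: $(\mathbf B,\phi)\in\mathcal C_X$ iff $(\mathbf B,f\circ\phi)\in\mathcal C_Y$; non-injective maps are not age maps. Embeddings. Let $\mathbf A$ be enumerated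 with $\mathrm{Age}(\mathbf A)\subseteq\mathcal K$. A map $f:T(<|\mathbf A|)\to T$ is an embedding of $\mathrm{ct}^{\mathbf A}$ into $\mathrm{ct}$ if (1) $f$ is injective; (2) there is an increasing $\tilde f:|\mathbf A|\to\omega$ with $f[T(j)]\subseteq T(\tilde f(j))$; (3) $f(s\wedge t)=f(s)\wedge f(t)$; (4) $f(s^\frown i)\sqsupseteq f(s)^\frown i$; (5) $f(c^{\mathbf A}(j))=c(\tilde f(j))$ and $u^{\mathbf A}(j)=u(\tilde f(j))$ for $j<|\mathbf A|$. It is an aged embedding if moreover each $f|_{T(j)}:(T(j),\mathcal C^{\mathbf A}(j))\to(T(\tilde f(j)),\mathcal C(\tilde f(j)))$ is an age map; $\mathrm{AEmb}(\mathrm{ct}^{\mathbf A},\mathrm{ct})$ is the set of these. Envelopes. For finite $S\subseteq\omega$, let $i_S:|S|\to S$ be the increasing bijection and let $\mathbf K_S$ be the structure on $|S|$ making $i_S$ an embedding into $\mathbf K$; set $\mathrm{ct}^S=\mathrm{ct}^{\mathbf K_S}$. $S$ is an envelope if there is $f\in\mathrm{AEmb}(\mathrm{ct}^S,\mathrm{ct})$ with $\tilde f=i_S$. -}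

module Defs where

open import Data.Nat using (ℕ; zero; suc; _+_; _≤_; _<_)
open import Data.Nat.Properties using () renaming (_≟_ to _≟ℕ_)
open import Data.Fin using (Fin; toℕ; splitAt; inject₁) renaming (zero to fzero; suc to fsuc)
open import Data.Fin.Properties using () renaming (_≟_ to _≟F_)
open import Data.List using (List; []; _∷_; length; map; upTo; take; _++_; [_])
open import Data.List.Membership.Propositional using (_∈_)
open import Data.Product using (Σ; ∃; ∃-syntax; _×_; _,_)
open import Data.Sum using (_⊎_; inj₁; inj₂)
open import Relation.Binary.PropositionalEquality using (_≡_; _≢_)
open import Relation.Nullary using (¬_; yes; no)
open import Function.Bundles using (_⇔_)

-- Language with k+1 unary symbols U_0..U_k and k+1 binary symbols
-- R_0..R_k (Flip(0)=0 forces at least one symbol).  A structure is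
-- represented by its "colour" functions: U a = i  iff  U_i(a),
-- R a b = i iff R_i(a,b) (a ≠ b).  Since R_i is only defined off the
-- diagonal, we normalise R a a = 0 (every genuine L-structure has a
-- unique such representation).

Lab : ℕ → Set
Lab k = Fin (suc k)

record FinStr (k : ℕ) : Set where
  constructor finStr
  field
    size : ℕ
    U    : Fin size → Lab k
    R    : Fin size → Fin size → Lab k
open FinStr public

-- enumerated structure on ω (or restriction-data of a finite enumerated
-- structure: only values below its size are ever used)
record EnumStr (k : ℕ) : Set where
  constructor enumStr
  field
    Uω : ℕ → Lab k
    Rω : ℕ → ℕ → Lab k
open EnumStr public

module _ {k : ℕ} (Flip : Lab k → Lab k) where

  WF : FinStr k → Set
  WF A = (∀ a → R A a a ≡ fzero) × (∀ a b → R A b a ≡ Flip (R A a b))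

  WFω : EnumStr k → Set
  WFω A = (∀ a → Rω A a a ≡ fzero) × (∀ a b → Rω A b a ≡ Flip (Rω A a b))

IsEmb : ∀ {k} (A B : FinStr k) → (Fin (size A) → Fin (size B)) → Set
IsEmb A B f = (∀ a a' → f a ≡ f a' → a ≡ a')
            × (∀ a → U B (f a) ≡ U A a)
            × (∀ a a' → R B (f a) (f a') ≡ R A a a')

IsEmbω : ∀ {k} (A : FinStr k) (K : EnumStr k) → (Fin (size A) → ℕ) → Set
IsEmbω A K f = (∀ a a' → f a ≡ f a' → a ≡ a')
             × (∀ a → Uω K (f a) ≡ U A a)
             × (∀ a a' → Rω K (f a) (f a') ≡ R A a a')

Age : ∀ {k} → EnumStr k → FinStr k → Set
Age K A = Σ (Fin (size A) → ℕ) (IsEmbω A K)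

FreeAmalgamation : ∀ {k} → (FinStr k → Set) → Set
FreeAmalgamation {k} 𝒦 =
  ∀ (A B C : FinStr k) (f : Fin (size A) → Fin (size B)) (g : Fin (size A) → Fin (size C)) →
  𝒦 A → 𝒦 B → 𝒦 C → IsEmb A B f → IsEmb A C g →
  Σ (FinStr k) λ D → Σ (Fin (size B) → Fin (size D)) λ r → Σ (Fin (size C) → Fin (size D)) λ s →
    𝒦 D × IsEmb B D r × IsEmb C D s
    × (∀ a → r (f a) ≡ s (g a))
    × (∀ d → (∃[ b ] r b ≡ d) ⊎ (∃[ c ] s c ≡ d))
    × (∀ b c → r b ≡ s c → ∃[ a ] r (f a) ≡ r b)
    × (∀ d d' → R D d d' ≢ fzero →
         ((∃[ b ] r b ≡ d) × (∃[ b ] r b ≡ d')) ⊎ ((∃[ c ] s c ≡ d) × (∃[ c ] s c ≡ d')))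

-- ultrahomogeneity of a structure on ω: every isomorphism between finite
-- substructures (given as two embeddings of the same finite structure)
-- extends to an automorphism
Ultrahomogeneous : ∀ {k} → EnumStr k → Set
Ultrahomogeneous {k} K =
  ∀ (A : FinStr k) (e₁ e₂ : Fin (size A) → ℕ) → IsEmbω A K e₁ → IsEmbω A K e₂ →
  Σ (ℕ → ℕ) λ σ → Σ (ℕ → ℕ) λ τ →
    (∀ x → τ (σ x) ≡ x) × (∀ x → σ (τ x) ≡ x)
    × (∀ x → Uω K (σ x) ≡ Uω K x) × (∀ x y → Rω K (σ x) (σ y) ≡ Rω K x y)
    × (∀ a → σ (e₁ a) ≡ e₂ a)

extMap : (m n : ℕ) → Fin (suc m) → ℕ
extMap m n x with toℕ x ≟ℕ m
... | yes _ = n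
... | no _  = toℕ x

LeftDense : ∀ {k} → (FinStr k → Set) → EnumStr k → Set
LeftDense {k} 𝒦 K =
  ∀ (m : ℕ) (UA : Fin (suc m) → Lab k) (RA : Fin (suc m) → Fin (suc m) → Lab k) →
  𝒦 (finStr (suc m) UA RA) →
  (∀ (i : Fin m) → UA (inject₁ i) ≡ Uω K (toℕ i)) →
  (∀ (i j : Fin m) → RA (inject₁ i) (inject₁ j) ≡ Rω K (toℕ i) (toℕ j)) →
  ∃[ n ] (m ≤ n × IsEmbω (finStr (suc m) UA RA) K (extMap m n)
          × (∀ r → m ≤ r → r < n → Rω K r n ≡ fzero))

-- Trees: nodes of T = k^{<ω} are lists; T(n) = lists of length n.

Node : ℕ → Set
Node k = List (Lab k)

meet : ∀ {k} → Node k → Node k → Node k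
meet (x ∷ xs) (y ∷ ys) with x ≟F y
... | yes _ = x ∷ meet xs ys
... | no _  = []
meet _ _ = []

_⊑_ : ∀ {k} → Node k → Node k → Set
s ⊑ t = ∃[ r ] s ++ r ≡ t

-- s(i), with a junk default 0 outside the domain (never used on
-- well-formed inputs)
nth : ∀ {k} → Node k → ℕ → Lab k
nth [] _ = fzero
nth (x ∷ xs) zero = x
nth (x ∷ xs) (suc i) = nth xs i

nthℕ : List ℕ → ℕ → ℕ
nthℕ [] _ = zero
nthℕ (x ∷ xs) zero = x
nthℕ (x ∷ xs) (suc i) = nthℕ xs i

code : ∀ {k} → EnumStr k → ℕ → Node k
code A j = map (λ i → Rω A i j) (upTo j)

-- Labeled structures.  B[φ,A] is built on Fin (m + size B): the first m
-- points are A_m (point i ↦ i), the rest are the points of B.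

Glue : ∀ {k} → (Lab k → Lab k) → ℕ → EnumStr k → (B : FinStr k) → (Fin (size B) → Node k) → FinStr k
Glue {k} Flip m A B φ = finStr (m + size B) UG RG
  where
  UG : Fin (m + size B) → Lab k
  UG x with splitAt m x
  ... | inj₁ i = Uω A (toℕ i)
  ... | inj₂ b = U B b
  RG : Fin (m + size B) → Fin (m + size B) → Lab k
  RG x y with splitAt m x | splitAt m y
  ... | inj₁ i | inj₁ j = Rω A (toℕ i) (toℕ j)
  ... | inj₁ i | inj₂ b = nth (φ b) (toℕ i)
  ... | inj₂ b | inj₁ i = Flip (nth (φ b) (toℕ i))
  ... | inj₂ b | inj₂ b' = R B b b'

𝒞 : ∀ {k} → (Lab k → Lab k) → (FinStr k → Set) → EnumStr k → ℕ →
    (B : FinStr k) → (Fin (size B) → Node k) → Set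
𝒞 Flip 𝒦 A m B φ = (∀ b → length (φ b) ≡ m) × 𝒦 (Glue Flip m A B φ)

Lev : ∀ {k} → ℕ → Node k → Set
Lev m t = length t ≡ m

AgeMap : ∀ {k} → (Lab k → Lab k) → (X Y : Node k → Set) →
         (CX CY : (B : FinStr k) → (Fin (size B) → Node k) → Set) →
         (Node k → Node k) → Set
AgeMap {k} Flip X Y CX CY f =
  (∀ x → X x → Y (f x))
  × (∀ x y → X x → X y → f x ≡ f y → x ≡ y)
  × (∀ (B : FinStr k) → WF Flip B → (φ : Fin (size B) → Node k) → (∀ b → X (φ b)) →
       CX B φ ⇔ CY B (λ b → f (φ b)))

-- K_S for S given as a strictly increasing list s (so i_S(j) = nthℕ s j)

subStr : ∀ {k} → EnumStr k → List ℕ → EnumStr k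
subStr K s = enumStr (λ j → Uω K (nthℕ s j)) (λ i j → Rω K (nthℕ s i) (nthℕ s j))

-- f ∈ AEmb(ct^S, ct) with f̃ = i_S ; f is only constrained on T(<|S|)
IsAEmbS : ∀ {k} → (Lab k → Lab k) → (FinStr k → Set) → EnumStr k → List ℕ →
          (Node k → Node k) → Set
IsAEmbS {k} Flip 𝒦 K s f =
  (∀ (x y : Node k) → length x < N → length y < N → f x ≡ f y → x ≡ y)
  × (∀ (j : ℕ) (x : Node k) → j < N → length x ≡ j → length (f x) ≡ nthℕ s j)
  × (∀ (x y : Node k) → length x < N → length y < N → f (meet x y) ≡ meet (f x) (f y))
  × (∀ (x : Node k) (i : Lab k) → length (x ++ [ i ]) < N → (f x ++ [ i ]) ⊑ f (x ++ [ i ]))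
  × (∀ (j : ℕ) → j < N → f (code A j) ≡ code K (nthℕ s j) × Uω A j ≡ Uω K (nthℕ s j))
  × (∀ (j : ℕ) → j < N →
       AgeMap Flip (Lev j) (Lev (nthℕ s j)) (𝒞 Flip 𝒦 A j) (𝒞 Flip 𝒦 K (nthℕ s j)) f)
  where
  N = length s
  A = subStr K s

Envelope : ∀ {k} → (Lab k → Lab k) → (FinStr k → Set) → EnumStr k → List ℕ → Set
Envelope {k} Flip 𝒦 K s = Σ (Node k → Node k) (IsAEmbS Flip 𝒦 K s)

Cond1 : ∀ {k} → EnumStr k → List ℕ → Set
Cond1 K s = ∀ m n → m ∈ s → n ∈ s → length (meet (code K m) (code K n)) ∈ s

CSrestr : ∀ {k} → EnumStr k → List ℕ → ℕ → Node k → Set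
CSrestr K s m t = ∃[ a ] (a ∈ s × suc m ≤ a × t ≡ take (suc m) (code K a))

-- condition (2); "m ≤ max S" is read as "m ≤ a for some a ∈ S"
Cond2 : ∀ {k} → (Lab k → Lab k) → (FinStr k → Set) → EnumStr k → List ℕ → Set
Cond2 Flip 𝒦 K s =
  ∀ m → (∃[ a ] (a ∈ s × m ≤ a)) → ¬ (m ∈ s) →
  AgeMap Flip (CSrestr K s m) (Lev m) (𝒞 Flip 𝒦 K (suc m)) (𝒞 Flip 𝒦 K m) (take m)

module Submission where

-- The central notion is a realisation: a T(m)-labeled (B, φ) is realised over points
-- P 0, …, P (m-1) of K if B embeds into K off these points with R(P i, ι b) = φ b (i).  By
-- ultrahomogeneity, B[φ, X] ∈ 𝒦 iff (B, φ) is realised over any copy P of X_m in K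
-- (glue⇔realisation), so each class 𝒞^X(m) becomes a statement about realisations in K.
-- After general facts on nodes, increasing lists and glued structures, two facts carry the proof:
--  * one-point extension: realising B over m+1 points is realising B plus the m-th point over the
--    first m points (realisation-absorb / realisation-emit);
--  * the amalgamation step: at a level p where restriction is an age map, a realisation over K_p
--    whose labels at p copy nodes of c[S] or are 0 extends to K_{p+1}, by free amalgamation
--    (realisation-step).
-- Forward direction: f preserves meets, giving (1); (2) follows by pulling a labeled structure back
-- along f at the least level of S above m.  Backward direction: f is defined explicitly (levels of S
-- copy the node, other levels copy a compatible coding node of S, or are 0) and shown to be an aged
-- embedding, by induction on the level alternating one-point extensions at the levels of S with
-- amalgamation steps at the levels in between.

open import Data.Nat using (ℕ; zero; suc; _+_; _∸_; _≤_; _<_; z≤n; s≤s; _≟_; _<?_)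
open import Data.Nat.Properties
open import Data.Fin using (Fin; toℕ; splitAt; join; _↑ˡ_; _↑ʳ_; fromℕ<; fromℕ; inject₁)
  renaming (zero to fzero; suc to fsuc)
open import Data.Fin.Properties
  using (splitAt-↑ˡ; splitAt-↑ʳ; join-splitAt; ↑ˡ-injective; ↑ʳ-injective; toℕ-injective; toℕ-fromℕ<;
         toℕ<n; toℕ-fromℕ; toℕ-inject₁; inject₁-injective; fromℕ≢inject₁)
  renaming (_≟_ to _≟F_; suc-injective to fsuc-injective)
open import Data.List using (List; []; _∷_; length; map; upTo; applyUpTo; take; drop; _++_; [_])
open import Data.List.Properties using (length-map; length-applyUpTo; length-take; take++drop≡id; ++-assoc; ++-identityʳ; length-++)
open import Data.List.Relation.Unary.All using (All; _∷_)
open import Data.List.Relation.Unary.Any using (here; there)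
open import Data.List.Relation.Unary.AllPairs using (AllPairs; _∷_)
open import Data.List.Membership.Propositional using (_∈_)
open import Data.Product using (Σ; ∃-syntax; _×_; _,_; proj₁; proj₂)
open import Data.Sum using (_⊎_; inj₁; inj₂) renaming ([_,_] to either)
open import Data.Empty using (⊥-elim)
open import Relation.Binary.PropositionalEquality using (_≡_; _≢_; refl; sym; trans; cong; cong₂; subst; module ≡-Reasoning)
open import Relation.Binary.Definitions using (Tri; tri<; tri≈; tri>)
open import Relation.Nullary using (¬_; yes; no; Dec)
open import Relation.Nullary.Decidable using (_×-dec_; _→-dec_)
open import Function using (_∘_; id)
open import Function.Bundles using (_⇔_; mk⇔; Equivalence)
open import Function.Properties.Equivalence using () renaming (trans to ⇔-trans; refl to ⇔-refl; sym to ⇔-sym)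
open import Defs

private variable k : ℕ

-- Nodes of the tree T as lists: indexing, restriction and meets.

nth-mapUpTo : ∀ (g : ℕ → Lab k) (h : ℕ → ℕ) n i → i < n → nth (map g (applyUpTo h n)) i ≡ g (h i)
nth-mapUpTo g h (suc n) zero _ = refl
nth-mapUpTo g h (suc n) (suc i) (s≤s i<n) = nth-mapUpTo g (h ∘ suc) n i i<n

length-mapUpTo : ∀ (g : ℕ → Lab k) n → length (map g (upTo n)) ≡ n
length-mapUpTo g n = trans (length-map g (upTo n)) (length-applyUpTo id n)

length-code : ∀ (X : EnumStr k) j → length (code X j) ≡ j
length-code X j = length-mapUpTo (λ i → Rω X i j) j

nth-code : ∀ (X : EnumStr k) j i → i < j → nth (code X j) i ≡ Rω X i j
nth-code X j i = nth-mapUpTo (λ i → Rω X i j) id j i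

nth-take : ∀ (u : Node k) n i → i < n → nth (take n u) i ≡ nth u i
nth-take [] (suc n) i _ = refl
nth-take (x ∷ u) (suc n) zero _ = refl
nth-take (x ∷ u) (suc n) (suc i) (s≤s i<n) = nth-take u n i i<n

length-take≤ : ∀ (u : Node k) n → n ≤ length u → length (take n u) ≡ n
length-take≤ u n n≤ = trans (length-take n u) (m≤n⇒m⊓n≡m n≤)

length-take-code : ∀ (X : EnumStr k) a n → n ≤ a → length (take n (code X a)) ≡ n
length-take-code X a n n≤a = length-take≤ (code X a) n (subst (n ≤_) (sym (length-code X a)) n≤a)

nth-ext : ∀ (u v : Node k) → length u ≡ length v → (∀ i → i < length u → nth u i ≡ nth v i) → u ≡ v
nth-ext [] [] _ _ = refl
nth-ext (x ∷ u) (y ∷ v) l e = cong₂ _∷_ (e 0 (s≤s z≤n)) (nth-ext u v (suc-injective l) (λ i p → e (suc i) (s≤s p)))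

nth-++ˡ : ∀ (u v : Node k) i → i < length u → nth (u ++ v) i ≡ nth u i
nth-++ˡ (x ∷ u) v zero _ = refl
nth-++ˡ (x ∷ u) v (suc i) (s≤s i<) = nth-++ˡ u v i i<

nth-snoc : ∀ (u : Node k) a → nth (u ++ [ a ]) (length u) ≡ a
nth-snoc [] a = refl
nth-snoc (x ∷ u) a = nth-snoc u a

length-snoc : ∀ (u : Node k) a → length (u ++ [ a ]) ≡ suc (length u)
length-snoc [] a = refl
length-snoc (x ∷ u) a = cong suc (length-snoc u a)

meet-length≤ˡ : ∀ (u v : Node k) → length (meet u v) ≤ length u
meet-length≤ˡ [] v = z≤n
meet-length≤ˡ (x ∷ u) [] = z≤n
meet-length≤ˡ (x ∷ u) (y ∷ v) with x ≟F y
... | yes _ = s≤s (meet-length≤ˡ u v)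
... | no _ = z≤n

meet-length≤ʳ : ∀ (u v : Node k) → length (meet u v) ≤ length v
meet-length≤ʳ [] v = z≤n
meet-length≤ʳ (x ∷ u) [] = z≤n
meet-length≤ʳ (x ∷ u) (y ∷ v) with x ≟F y
... | yes _ = s≤s (meet-length≤ʳ u v)
... | no _ = z≤n

meet-agree : ∀ (u v : Node k) i → i < length (meet u v) → nth u i ≡ nth v i
meet-agree (x ∷ u) (y ∷ v) i p with x ≟F y
meet-agree (x ∷ u) (y ∷ v) zero p | yes e = e
meet-agree (x ∷ u) (y ∷ v) (suc i) (s≤s p) | yes e = meet-agree u v i p
meet-agree (x ∷ u) (y ∷ v) i () | no _

meet-split : ∀ (u v : Node k) → length (meet u v) < length u → length (meet u v) < length v →
             nth u (length (meet u v)) ≢ nth v (length (meet u v))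
meet-split (x ∷ u) (y ∷ v) p q with x ≟F y
... | yes _ = meet-split u v (≤-pred p) (≤-pred q)
... | no x≢y = x≢y

meet-is-take : ∀ (u v : Node k) → meet u v ≡ take (length (meet u v)) u
meet-is-take [] v = refl
meet-is-take (x ∷ u) [] = refl
meet-is-take (x ∷ u) (y ∷ v) with x ≟F y
... | yes _ = cong (x ∷_) (meet-is-take u v)
... | no _ = refl

MeetEnd : Node k → Node k → ℕ → Set
MeetEnd u v n = n ≡ length u ⊎ n ≡ length v ⊎ nth u n ≢ nth v n

meet-char : ∀ (u v : Node k) n → n ≤ length u → n ≤ length v → (∀ i → i < n → nth u i ≡ nth v i) →
            MeetEnd u v n → meet u v ≡ take n u
meet-char [] v zero _ _ _ _ = refl
meet-char (x ∷ u) [] zero _ _ _ _ = refl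
meet-char (x ∷ u) (y ∷ v) zero _ _ _ (inj₁ ())
meet-char (x ∷ u) (y ∷ v) zero _ _ _ (inj₂ (inj₁ ()))
meet-char (x ∷ u) (y ∷ v) zero _ _ _ (inj₂ (inj₂ x≢y)) with x ≟F y
... | yes x≡y = ⊥-elim (x≢y x≡y)
... | no _ = refl
meet-char (x ∷ u) (y ∷ v) (suc n) (s≤s p) (s≤s q) agree end with x ≟F y
... | no x≢y = ⊥-elim (x≢y (agree 0 (s≤s z≤n)))
... | yes _ = cong (x ∷_) (meet-char u v n p q (λ i r → agree (suc i) (s≤s r)) (tail end))
  where
  tail : MeetEnd (x ∷ u) (y ∷ v) (suc n) → MeetEnd u v n
  tail (inj₁ e) = inj₁ (suc-injective e)
  tail (inj₂ (inj₁ e)) = inj₂ (inj₁ (suc-injective e))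
  tail (inj₂ (inj₂ e)) = inj₂ (inj₂ e)

take-++ : ∀ {A : Set} (u r : List A) → take (length u) (u ++ r) ≡ u
take-++ [] r = refl
take-++ (x ∷ u) r = cong (x ∷_) (take-++ u r)

⊑-trans : {u v w : Node k} → u ⊑ v → v ⊑ w → u ⊑ w
⊑-trans {u = u} (r , refl) (r' , refl) = r ++ r' , sym (++-assoc u r r')

⊑-snoc : {u v : Node k} {a : Lab k} → (u ++ [ a ]) ⊑ v → u ⊑ v
⊑-snoc {u = u} {a = a} (r , refl) = a ∷ r , sym (++-assoc u [ a ] r)

⊑-take : {u v : Node k} → u ⊑ v → take (length u) v ≡ u
⊑-take {u = u} (r , refl) = take-++ u r

module _ {P : ℕ → Set} (P? : ∀ i → Dec (P i)) where

  least-below : ∀ n → (∃[ i ] (i < n × P i)) → ∃[ l ] (l < n × P l × (∀ i → i < l → ¬ P i))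
  least-below (suc n) (i , i<1+n , pi) with anyUpTo? P? n
  ... | yes w = let (l , l<n , pl , minimal) = least-below n w in l , m≤n⇒m≤1+n l<n , pl , minimal
  ... | no none = i , i<1+n , pi , λ j j<i pj → none (j , <-≤-trans j<i (≤-pred i<1+n) , pj)

-- A strictly increasing list s enumerates S = {S 0 < S 1 < … < S (N-1)}, i.e. i_S = S.
module Increasing (s : List ℕ) (s-sorted : AllPairs _<_ s) where

  N : ℕ
  N = length s

  S : ℕ → ℕ
  S = nthℕ s

  private
    below-all : ∀ {x} (xs : List ℕ) → All (x <_) xs → ∀ j → j < length xs → x < nthℕ xs j
    below-all (y ∷ ys) (x<y ∷ _) zero _ = x<y
    below-all (y ∷ ys) (_ ∷ rest) (suc j) (s≤s j<) = below-all ys rest j j<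

    increasing : ∀ (xs : List ℕ) → AllPairs _<_ xs → ∀ i j → i < j → j < length xs → nthℕ xs i < nthℕ xs j
    increasing (x ∷ xs) (x< ∷ _) zero (suc j) _ (s≤s j<) = below-all xs x< j j<
    increasing (x ∷ xs) (_ ∷ sorted) (suc i) (suc j) (s≤s i<j) (s≤s j<) = increasing xs sorted i j i<j j<

    index-of : ∀ (xs : List ℕ) a → a ∈ xs → ∃[ i ] (i < length xs × nthℕ xs i ≡ a)
    index-of (x ∷ xs) a (here refl) = 0 , s≤s z≤n , refl
    index-of (x ∷ xs) a (there a∈) = let (i , i< , e) = index-of xs a a∈ in suc i , s≤s i< , e

    member-at : ∀ (xs : List ℕ) i → i < length xs → nthℕ xs i ∈ xs
    member-at (x ∷ xs) zero _ = here refl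
    member-at (x ∷ xs) (suc i) (s≤s i<) = there (member-at xs i i<)

  S-mono : ∀ i j → i < j → j < N → S i < S j
  S-mono = increasing s s-sorted

  S-mono≤ : ∀ i j → i ≤ j → j < N → S i ≤ S j
  S-mono≤ i j i≤j j<N with m≤n⇒m<n∨m≡n i≤j
  ... | inj₁ i<j = <⇒≤ (S-mono i j i<j j<N)
  ... | inj₂ refl = ≤-refl

  S-reflect< : ∀ i j → i < N → j < N → S i < S j → i < j
  S-reflect< i j i<N j<N Si<Sj with <-cmp i j
  ... | tri< i<j _ _ = i<j
  ... | tri≈ _ refl _ = ⊥-elim (<-irrefl refl Si<Sj)
  ... | tri> _ _ j<i = ⊥-elim (<-asym Si<Sj (S-mono j i j<i i<N))

  S-reflect≤ : ∀ i j → i < N → j < N → S i ≤ S j → i ≤ j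
  S-reflect≤ i j i<N j<N Si≤Sj with <-cmp i j
  ... | tri< i<j _ _ = <⇒≤ i<j
  ... | tri≈ _ refl _ = ≤-refl
  ... | tri> _ _ j<i = ⊥-elim (<⇒≱ (S-mono j i j<i i<N) Si≤Sj)

  S-injective : ∀ i j → i < N → j < N → S i ≡ S j → i ≡ j
  S-injective i j i<N j<N e = ≤-antisym (S-reflect≤ i j i<N j<N (≤-reflexive e)) (S-reflect≤ j i j<N i<N (≤-reflexive (sym e)))

  ∈⇒index : ∀ a → a ∈ s → ∃[ i ] (i < N × S i ≡ a)
  ∈⇒index = index-of s

  index⇒∈ : ∀ i → i < N → S i ∈ s
  index⇒∈ = member-at s

  InS : ℕ → Set
  InS p = ∃[ i ] (i < N × S i ≡ p)

  InS? : ∀ p → Dec (InS p)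
  InS? p = anyUpTo? (λ i → S i ≟ p) N

  ¬InS⇒∉S : ∀ p → ¬ InS p → ¬ (p ∈ s)
  ¬InS⇒∉S p ¬in p∈s = ¬in (∈⇒index p p∈s)

record Selection (n : ℕ) (P : Fin n → Set) : Set where
  field
    count : ℕ
    embed : Fin count → Fin n
    embed-injective : ∀ y y' → embed y ≡ embed y' → y ≡ y'
    sound : ∀ y → P (embed y)
    complete : ∀ x → P x → ∃[ y ] embed y ≡ x

select : ∀ n (P : Fin n → Set) → (∀ x → Dec (P x)) → Selection n P
select zero P P? = record { count = 0 ; embed = λ () ; embed-injective = λ () ; sound = λ () ; complete = λ () }
select (suc n) P P? with select n (P ∘ fsuc) (P? ∘ fsuc) | P? fzero
... | sel | no ¬P0 = record
  { count = count ; embed = fsuc ∘ embed ; embed-injective = λ y y' e → embed-injective y y' (fsuc-injective e)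
  ; sound = sound ; complete = complete' }
  where
  open Selection sel
  complete' : ∀ x → P x → ∃[ y ] fsuc (embed y) ≡ x
  complete' fzero P0 = ⊥-elim (¬P0 P0)
  complete' (fsuc x) Px = let (y , e) = complete x Px in y , cong fsuc e
... | sel | yes P0 = record
  { count = suc count ; embed = embed' ; embed-injective = injective' ; sound = sound' ; complete = complete' }
  where
  open Selection sel
  embed' : Fin (suc count) → Fin (suc n)
  embed' fzero = fzero
  embed' (fsuc y) = fsuc (embed y)
  injective' : ∀ y y' → embed' y ≡ embed' y' → y ≡ y'
  injective' fzero fzero _ = refl
  injective' (fsuc y) (fsuc y') e = cong fsuc (embed-injective y y' (fsuc-injective e))
  sound' : ∀ y → P (embed' y)
  sound' fzero = P0
  sound' (fsuc y) = sound y
  complete' : ∀ x → P x → ∃[ y ] embed' y ≡ x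
  complete' fzero _ = fzero , refl
  complete' (fsuc x) Px = let (y , e) = complete x Px in fsuc y , cong fsuc e

last-view : ∀ {p} (i : Fin (suc p)) → (∃[ j ] i ≡ inject₁ j) ⊎ i ≡ fromℕ p
last-view {p} i with toℕ i <? p
... | yes i<p = inj₁ (fromℕ< i<p , toℕ-injective (sym (trans (toℕ-inject₁ (fromℕ< i<p)) (toℕ-fromℕ< i<p))))
... | no i≮p = inj₂ (toℕ-injective (trans (≤-antisym (≤-pred (toℕ<n i)) (≮⇒≥ i≮p)) (sym (toℕ-fromℕ p))))

-- The glued structure B[φ, X] on Fin (m + |B|): the first m points are X_m, the others B.
-- Below, i ↑ˡ n is the i-th point of X_m and m ↑ʳ b the point b of B.

module _ (Flip : Lab k → Lab k) (m : ℕ) (X : EnumStr k) (B : FinStr k) (φ : Fin (size B) → Node k) where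
  private
    G = Glue Flip m X B φ
    n = size B

  glue-Uˡ : ∀ i → U G (i ↑ˡ n) ≡ Uω X (toℕ i)
  glue-Uˡ i rewrite splitAt-↑ˡ m i n = refl

  glue-Uʳ : ∀ b → U G (m ↑ʳ b) ≡ U B b
  glue-Uʳ b rewrite splitAt-↑ʳ m n b = refl

  glue-Rˡˡ : ∀ i j → R G (i ↑ˡ n) (j ↑ˡ n) ≡ Rω X (toℕ i) (toℕ j)
  glue-Rˡˡ i j rewrite splitAt-↑ˡ m i n | splitAt-↑ˡ m j n = refl

  glue-Rˡʳ : ∀ i b → R G (i ↑ˡ n) (m ↑ʳ b) ≡ nth (φ b) (toℕ i)
  glue-Rˡʳ i b rewrite splitAt-↑ˡ m i n | splitAt-↑ʳ m n b = refl

  glue-Rʳˡ : ∀ b i → R G (m ↑ʳ b) (i ↑ˡ n) ≡ Flip (nth (φ b) (toℕ i))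
  glue-Rʳˡ b i rewrite splitAt-↑ˡ m i n | splitAt-↑ʳ m n b = refl

  glue-Rʳʳ : ∀ b b' → R G (m ↑ʳ b) (m ↑ʳ b') ≡ R B b b'
  glue-Rʳʳ b b' rewrite splitAt-↑ʳ m n b | splitAt-↑ʳ m n b' = refl

split-view : ∀ {m n} (x : Fin (m + n)) → (∃[ i ] x ≡ i ↑ˡ n) ⊎ (∃[ b ] x ≡ m ↑ʳ b)
split-view {m} {n} x with splitAt m x in eq
... | inj₁ i = inj₁ (i , trans (sym (join-splitAt m n x)) (cong (join m n) eq))
... | inj₂ b = inj₂ (b , trans (sym (join-splitAt m n x)) (cong (join m n) eq))

↑ˡ≢↑ʳ : ∀ {m n} (i : Fin m) (b : Fin n) → i ↑ˡ n ≢ m ↑ʳ b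
↑ˡ≢↑ʳ {m} {n} i b e with trans (sym (splitAt-↑ˡ m i n)) (trans (cong (splitAt m) e) (splitAt-↑ʳ m n b))
... | ()

IsEmbInto : (A : FinStr k) (T : Set) (UT : T → Lab k) (RT : T → T → Lab k) → (Fin (size A) → T) → Set
IsEmbInto A T UT RT f = (∀ a a' → f a ≡ f a' → a ≡ a') × (∀ a → UT (f a) ≡ U A a) × (∀ a a' → RT (f a) (f a') ≡ R A a a')

module _ (Flip : Lab k → Lab k) (m : ℕ) (X : EnumStr k) (B : FinStr k) (φ : Fin (size B) → Node k)
         {T : Set} (UT : T → Lab k) (RT : T → T → Lab k) (e : Fin (m + size B) → T) where
  private n = size B

  glue-embedding :
    (∀ i j → e (i ↑ˡ n) ≡ e (j ↑ˡ n) → i ≡ j) →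
    (∀ b b' → e (m ↑ʳ b) ≡ e (m ↑ʳ b') → b ≡ b') →
    (∀ i b → e (i ↑ˡ n) ≢ e (m ↑ʳ b)) →
    (∀ i → UT (e (i ↑ˡ n)) ≡ Uω X (toℕ i)) →
    (∀ b → UT (e (m ↑ʳ b)) ≡ U B b) →
    (∀ i j → RT (e (i ↑ˡ n)) (e (j ↑ˡ n)) ≡ Rω X (toℕ i) (toℕ j)) →
    (∀ i b → RT (e (i ↑ˡ n)) (e (m ↑ʳ b)) ≡ nth (φ b) (toℕ i)) →
    (∀ b i → RT (e (m ↑ʳ b)) (e (i ↑ˡ n)) ≡ Flip (nth (φ b) (toℕ i))) →
    (∀ b b' → RT (e (m ↑ʳ b)) (e (m ↑ʳ b')) ≡ R B b b') →
    IsEmbInto (Glue Flip m X B φ) T UT RT e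
  glue-embedding inj-ll inj-rr apart u-l u-r r-ll r-lr r-rl r-rr = injective , unary , binary
    where
    injective : ∀ a a' → e a ≡ e a' → a ≡ a'
    injective a a' eq with split-view {m} {n} a | split-view {m} {n} a'
    ... | inj₁ (i , refl) | inj₁ (j , refl) = cong (_↑ˡ n) (inj-ll i j eq)
    ... | inj₁ (i , refl) | inj₂ (b , refl) = ⊥-elim (apart i b eq)
    ... | inj₂ (b , refl) | inj₁ (i , refl) = ⊥-elim (apart i b (sym eq))
    ... | inj₂ (b , refl) | inj₂ (b' , refl) = cong (m ↑ʳ_) (inj-rr b b' eq)
    unary : ∀ a → UT (e a) ≡ U (Glue Flip m X B φ) a
    unary a with split-view {m} {n} a
    ... | inj₁ (i , refl) = trans (u-l i) (sym (glue-Uˡ Flip m X B φ i))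
    ... | inj₂ (b , refl) = trans (u-r b) (sym (glue-Uʳ Flip m X B φ b))
    binary : ∀ a a' → RT (e a) (e a') ≡ R (Glue Flip m X B φ) a a'
    binary a a' with split-view {m} {n} a | split-view {m} {n} a'
    ... | inj₁ (i , refl) | inj₁ (j , refl) = trans (r-ll i j) (sym (glue-Rˡˡ Flip m X B φ i j))
    ... | inj₁ (i , refl) | inj₂ (b , refl) = trans (r-lr i b) (sym (glue-Rˡʳ Flip m X B φ i b))
    ... | inj₂ (b , refl) | inj₁ (i , refl) = trans (r-rl b i) (sym (glue-Rʳˡ Flip m X B φ b i))
    ... | inj₂ (b , refl) | inj₂ (b' , refl) = trans (r-rr b b') (sym (glue-Rʳʳ Flip m X B φ b b'))

restriction-level : ∀ (X : EnumStr k) s m x → CSrestr X s m x → Lev m (take m x)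
restriction-level X s m x (a , _ , m<a , refl) =
  length-take≤ _ m (≤-trans (n≤1+n m) (≤-reflexive (sym (length-take-code X a (suc m) m<a))))

-- … injectively when m ∉ S, by (1): two nodes of c[S]|_{m+1} with the same restriction to m but
-- different entries at m would split exactly at m, making m = ℓ(c(a) ∧ c(a')) ∈ S.
restriction-injective : ∀ (X : EnumStr k) s m → Cond1 X s → ¬ (m ∈ s) →
                        ∀ x y → CSrestr X s m x → CSrestr X s m y → take m x ≡ take m y → x ≡ y
restriction-injective X s m cond1 m∉s x y (a , a∈s , m<a , refl) (a' , a'∈s , m<a' , refl) x|m≡y|m
  with nth (code X a) m ≟F nth (code X a') m
... | yes same-at-m = nth-ext _ _ (trans (length-take-code X a (suc m) m<a) (sym (length-take-code X a' (suc m) m<a'))) entries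
  where
  entries : ∀ i → i < length (take (suc m) (code X a)) → nth (take (suc m) (code X a)) i ≡ nth (take (suc m) (code X a')) i
  entries i i< with m<1+n⇒m<n∨m≡n (subst (i <_) (length-take-code X a (suc m) m<a) i<)
  ... | inj₁ i<m = trans (sym (nth-take (take (suc m) (code X a)) m i i<m))
                         (trans (cong (λ v → nth v i) x|m≡y|m) (nth-take (take (suc m) (code X a')) m i i<m))
  ... | inj₂ refl = trans (nth-take (code X a) (suc m) i ≤-refl)
                          (trans same-at-m (sym (nth-take (code X a') (suc m) i ≤-refl)))
... | no differ-at-m = ⊥-elim (m∉s (subst (_∈ s) length-meet (cond1 a a' a∈s a'∈s)))
  where
  u = code X a
  v = code X a'
  m≤u : m ≤ length u
  m≤u = subst (m ≤_) (sym (length-code X a)) (≤-trans (n≤1+n m) m<a)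
  m≤v : m ≤ length v
  m≤v = subst (m ≤_) (sym (length-code X a')) (≤-trans (n≤1+n m) m<a')
  agree : ∀ i → i < m → nth u i ≡ nth v i
  agree i i<m = begin
    nth u i                           ≡⟨ sym (nth-take u (suc m) i (m≤n⇒m≤1+n i<m)) ⟩
    nth (take (suc m) u) i            ≡⟨ sym (nth-take _ m i i<m) ⟩
    nth (take m (take (suc m) u)) i   ≡⟨ cong (λ z → nth z i) x|m≡y|m ⟩
    nth (take m (take (suc m) v)) i   ≡⟨ nth-take _ m i i<m ⟩
    nth (take (suc m) v) i            ≡⟨ nth-take v (suc m) i (m≤n⇒m≤1+n i<m) ⟩
    nth v i                           ∎
    where open ≡-Reasoning
  length-meet : length (meet u v) ≡ m
  length-meet = trans (cong length (meet-char u v m m≤u m≤v agree (inj₂ (inj₂ differ-at-m)))) (length-take≤ u m m≤u)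

module Envelopes (Flip : Lab k → Lab k) (flip0 : Flip fzero ≡ fzero) (flip-involutive : ∀ i → Flip (Flip i) ≡ i)
  (𝒦 : FinStr k → Set) (K : EnumStr k) (K-wf : WFω Flip K) (𝒦≡Age : ∀ A → 𝒦 A ⇔ Age K A)
  (K-uh : Ultrahomogeneous K) where

  RK : ℕ → ℕ → Lab k
  RK = Rω K

  UK : ℕ → Lab k
  UK = Uω K

  RK-flip : ∀ a b → RK b a ≡ Flip (RK a b)
  RK-flip = proj₂ K-wf

  RK-diag : ∀ a → RK a a ≡ fzero
  RK-diag = proj₁ K-wf

  embeds⇒𝒦 : (A : FinStr k) (e : Fin (size A) → ℕ) → IsEmbInto A ℕ UK RK e → 𝒦 A
  embeds⇒𝒦 A e emb = Equivalence.from (𝒦≡Age A) (e , emb)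

  𝒦-hereditary : (A Y : FinStr k) (e : Fin (size A) → Fin (size Y)) → IsEmb A Y e → 𝒦 Y → 𝒦 A
  𝒦-hereditary A Y e (e-inj , e-U , e-R) 𝒦Y with Equivalence.to (𝒦≡Age Y) 𝒦Y
  ... | d , d-inj , d-U , d-R =
    embeds⇒𝒦 A (d ∘ e) ((λ a a' q → e-inj a a' (d-inj _ _ q)) , (λ a → trans (d-U (e a)) (e-U a)) ,
                         λ a a' → trans (d-R (e a) (e a')) (e-R a a'))

  𝒦-flip : (D : FinStr k) → 𝒦 D → ∀ a b → R D b a ≡ Flip (R D a b)
  𝒦-flip D 𝒦D a b with Equivalence.to (𝒦≡Age D) 𝒦D
  ... | d , _ , _ , d-R = trans (sym (d-R b a)) (trans (RK-flip (d a) (d b)) (cong Flip (d-R a b)))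

  Realised : ℕ → (ℕ → ℕ) → (B : FinStr k) → (Fin (size B) → Node k) → Set
  Realised m P B φ = Σ (Fin (size B) → ℕ) λ ι →
      (∀ b b' → ι b ≡ ι b' → b ≡ b')
    × (∀ b i → i < m → ι b ≢ P i)
    × (∀ b → UK (ι b) ≡ U B b)
    × (∀ b b' → RK (ι b) (ι b') ≡ R B b b')
    × (∀ b i → i < m → RK (P i) (ι b) ≡ nth (φ b) i)

  InjectiveBelow : ℕ → (ℕ → ℕ) → Set
  InjectiveBelow m P = ∀ i j → i < m → j < m → P i ≡ P j → i ≡ j

  Copies : EnumStr k → ℕ → (ℕ → ℕ) → Set
  Copies X m P = (∀ i j → i < m → j < m → RK (P i) (P j) ≡ Rω X i j)
               × (∀ i → i < m → UK (P i) ≡ Uω X i)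
               × InjectiveBelow m P

  copies-id : ∀ m → Copies K m id
  copies-id m = (λ _ _ _ _ → refl) , (λ _ _ → refl) , (λ _ _ _ _ e → e)

  initial : EnumStr k → ℕ → FinStr k
  initial X m = finStr m (λ i → Uω X (toℕ i)) (λ i j → Rω X (toℕ i) (toℕ j))

  copies⇒embedding : ∀ X m P → Copies X m P → IsEmbInto (initial X m) ℕ UK RK (P ∘ toℕ)
  copies⇒embedding X m P (P-R , P-U , P-inj) =
    (λ a a' e → toℕ-injective (P-inj _ _ (toℕ<n a) (toℕ<n a') e)) , (λ a → P-U _ (toℕ<n a)) ,
    λ a a' → P-R _ _ (toℕ<n a) (toℕ<n a')

  record Automorphism : Set where
    field
      σ : ℕ → ℕ
      σ⁻¹ : ℕ → ℕ
      σ⁻¹∘σ : ∀ x → σ⁻¹ (σ x) ≡ x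
      σ-U : ∀ x → UK (σ x) ≡ UK x
      σ-R : ∀ x y → RK (σ x) (σ y) ≡ RK x y
    σ-injective : ∀ x y → σ x ≡ σ y → x ≡ y
    σ-injective x y e = trans (sym (σ⁻¹∘σ x)) (trans (cong σ⁻¹ e) (σ⁻¹∘σ y))

  automorphism-extending : (A : FinStr k) (e₁ e₂ : Fin (size A) → ℕ) → IsEmbInto A ℕ UK RK e₁ → IsEmbInto A ℕ UK RK e₂ →
                           Σ Automorphism λ α → ∀ x → Automorphism.σ α (e₁ x) ≡ e₂ x
  automorphism-extending A e₁ e₂ emb₁ emb₂ with K-uh A e₁ e₂ emb₁ emb₂
  ... | σ , σ⁻¹ , σ⁻¹∘σ , _ , σ-U , σ-R , σe₁≡e₂ =
    record { σ = σ ; σ⁻¹ = σ⁻¹ ; σ⁻¹∘σ = σ⁻¹∘σ ; σ-U = σ-U ; σ-R = σ-R } , σe₁≡e₂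

  -- B[φ, X] ∈ 𝒦 iff (B, φ) is realised over a copy of X_m in K: a realisation is an embedding
  -- of B[φ, X] into K, and conversely an embedding of B[φ, X] is moved onto P by ultrahomogeneity.
  module _ (X : EnumStr k) (m : ℕ) (P : ℕ → ℕ) (P-copies : Copies X m P) (B : FinStr k) (φ : Fin (size B) → Node k) where
    private
      n = size B
      P-R = proj₁ P-copies
      P-U = proj₁ (proj₂ P-copies)
      P-inj = proj₂ (proj₂ P-copies)

    realisation⇒glue : Realised m P B φ → 𝒦 (Glue Flip m X B φ)
    realisation⇒glue (ι , ι-inj , ι-avoids , ι-U , ι-R , ι-labels) = embeds⇒𝒦 _ e
      (glue-embedding Flip m X B φ UK RK e
        (λ i j q → toℕ-injective (P-inj _ _ (toℕ<n i) (toℕ<n j) (trans (sym (eˡ i)) (trans q (eˡ j)))))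
        (λ b b' q → ι-inj b b' (trans (sym (eʳ b)) (trans q (eʳ b'))))
        (λ i b q → ι-avoids b (toℕ i) (toℕ<n i) (sym (trans (sym (eˡ i)) (trans q (eʳ b)))))
        (λ i → trans (cong UK (eˡ i)) (P-U _ (toℕ<n i)))
        (λ b → trans (cong UK (eʳ b)) (ι-U b))
        (λ i j → trans (cong₂ RK (eˡ i) (eˡ j)) (P-R _ _ (toℕ<n i) (toℕ<n j)))
        (λ i b → trans (cong₂ RK (eˡ i) (eʳ b)) (ι-labels b (toℕ i) (toℕ<n i)))
        (λ b i → trans (cong₂ RK (eʳ b) (eˡ i)) (trans (RK-flip _ _) (cong Flip (ι-labels b (toℕ i) (toℕ<n i)))))
        (λ b b' → trans (cong₂ RK (eʳ b) (eʳ b')) (ι-R b b')))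
      where
      e : Fin (m + n) → ℕ
      e x = either (P ∘ toℕ) ι (splitAt m x)
      eˡ : ∀ i → e (i ↑ˡ n) ≡ P (toℕ i)
      eˡ i rewrite splitAt-↑ˡ m i n = refl
      eʳ : ∀ b → e (m ↑ʳ b) ≡ ι b
      eʳ b rewrite splitAt-↑ʳ m n b = refl

    glue⇒realisation : 𝒦 (Glue Flip m X B φ) → Realised m P B φ
    glue⇒realisation 𝒦G with Equivalence.to (𝒦≡Age _) 𝒦G
    ... | d , d-inj , d-U , d-R with automorphism-extending (initial X m) (λ a → d (a ↑ˡ n)) (P ∘ toℕ)
           ((λ a a' q → ↑ˡ-injective n a a' (d-inj _ _ q)) , (λ a → trans (d-U _) (glue-Uˡ Flip m X B φ a)) ,
              λ a a' → trans (d-R _ _) (glue-Rˡˡ Flip m X B φ a a'))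
           (copies⇒embedding X m P P-copies)
    ... | α , σd≡P = ι , ι-inj , ι-avoids , ι-U , ι-R , ι-labels
      where
      open Automorphism α
      ι : Fin n → ℕ
      ι b = σ (d (m ↑ʳ b))
      σd≡P' : ∀ i (i<m : i < m) → σ (d (fromℕ< i<m ↑ˡ n)) ≡ P i
      σd≡P' i i<m = trans (σd≡P (fromℕ< i<m)) (cong P (toℕ-fromℕ< i<m))
      ι-inj : ∀ b b' → ι b ≡ ι b' → b ≡ b'
      ι-inj b b' q = ↑ʳ-injective m b b' (d-inj _ _ (σ-injective _ _ q))
      ι-avoids : ∀ b i → i < m → ι b ≢ P i
      ι-avoids b i i<m q = ↑ˡ≢↑ʳ (fromℕ< i<m) b (sym (d-inj _ _ (σ-injective _ _ (trans q (sym (σd≡P' i i<m))))))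
      ι-U : ∀ b → UK (ι b) ≡ U B b
      ι-U b = trans (σ-U _) (trans (d-U _) (glue-Uʳ Flip m X B φ b))
      ι-R : ∀ b b' → RK (ι b) (ι b') ≡ R B b b'
      ι-R b b' = trans (σ-R _ _) (trans (d-R _ _) (glue-Rʳʳ Flip m X B φ b b'))
      ι-labels : ∀ b i → i < m → RK (P i) (ι b) ≡ nth (φ b) i
      ι-labels b i i<m = begin
        RK (P i) (ι b)                               ≡⟨ cong (λ z → RK z (ι b)) (sym (σd≡P' i i<m)) ⟩
        RK (σ (d (fromℕ< i<m ↑ˡ n))) (ι b)           ≡⟨ σ-R _ _ ⟩
        RK (d (fromℕ< i<m ↑ˡ n)) (d (m ↑ʳ b))        ≡⟨ d-R _ _ ⟩
        R (Glue Flip m X B φ) (fromℕ< i<m ↑ˡ n) (m ↑ʳ b) ≡⟨ glue-Rˡʳ Flip m X B φ (fromℕ< i<m) b ⟩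
        nth (φ b) (toℕ (fromℕ< i<m))                 ≡⟨ cong (nth (φ b)) (toℕ-fromℕ< i<m) ⟩
        nth (φ b) i                                  ∎
        where open ≡-Reasoning

    glue⇔realisation : 𝒦 (Glue Flip m X B φ) ⇔ Realised m P B φ
    glue⇔realisation = mk⇔ glue⇒realisation realisation⇒glue

  realisation-move : ∀ m (P Q : ℕ → ℕ) → (∀ i j → i < m → j < m → RK (P i) (P j) ≡ RK (Q i) (Q j)) →
                     (∀ i → i < m → UK (P i) ≡ UK (Q i)) → InjectiveBelow m P → InjectiveBelow m Q →
                     ∀ B φ → Realised m P B φ → Realised m Q B φ
  realisation-move m P Q P≅Q-R P≅Q-U P-inj Q-inj B φ (ι , ι-inj , ι-avoids , ι-U , ι-R , ι-labels)
    with automorphism-extending (finStr m (λ i → UK (P (toℕ i))) (λ i j → RK (P (toℕ i)) (P (toℕ j)))) (P ∘ toℕ) (Q ∘ toℕ)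
            ((λ a a' e → toℕ-injective (P-inj _ _ (toℕ<n a) (toℕ<n a') e)) , (λ a → refl) , λ a a' → refl)
            ((λ a a' e → toℕ-injective (Q-inj _ _ (toℕ<n a) (toℕ<n a') e)) , (λ a → sym (P≅Q-U _ (toℕ<n a))) ,
              λ a a' → sym (P≅Q-R _ _ (toℕ<n a) (toℕ<n a')))
  ... | α , σP≡Q = σ ∘ ι , (λ b b' q → ι-inj b b' (σ-injective _ _ q)) ,
        (λ b i i<m q → ι-avoids b i i<m (σ-injective _ _ (trans q (sym (σP≡Q' i i<m))))) ,
        (λ b → trans (σ-U _) (ι-U b)) , (λ b b' → trans (σ-R _ _) (ι-R b b')) ,
        (λ b i i<m → trans (cong (λ z → RK z (σ (ι b))) (sym (σP≡Q' i i<m))) (trans (σ-R _ _) (ι-labels b i i<m)))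
    where
    open Automorphism α
    σP≡Q' : ∀ i (i<m : i < m) → σ (P i) ≡ Q i
    σP≡Q' i i<m = trans (cong (σ ∘ P) (sym (toℕ-fromℕ< i<m))) (trans (σP≡Q (fromℕ< i<m)) (cong Q (toℕ-fromℕ< i<m)))

  realisation-restrict : ∀ m P B φ → Realised m P B φ → ∀ m' Q (h : ℕ → ℕ) → (∀ i → i < m' → h i < m) →
                         (∀ i → i < m' → Q i ≡ P (h i)) → (ψ : Fin (size B) → Node k) →
                         (∀ b i → i < m' → nth (ψ b) i ≡ nth (φ b) (h i)) → Realised m' Q B ψ
  realisation-restrict m P B φ (ι , ι-inj , ι-avoids , ι-U , ι-R , ι-labels) m' Q h h< Q≡Ph ψ ψ≡φh =
    ι , ι-inj , (λ b i i<m' q → ι-avoids b (h i) (h< i i<m') (trans q (Q≡Ph i i<m'))) , ι-U , ι-R ,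
    (λ b i i<m' → trans (cong (λ z → RK z (ι b)) (Q≡Ph i i<m')) (trans (ι-labels b (h i) (h< i i<m')) (sym (ψ≡φh b i i<m'))))

  realisation-relabel : ∀ m P B φ ψ → (∀ b i → i < m → nth (ψ b) i ≡ nth (φ b) i) → Realised m P B φ → Realised m P B ψ
  realisation-relabel m P B φ ψ ψ≡φ r = realisation-restrict m P B φ r m P id (λ i i<m → i<m) (λ _ _ → refl) ψ ψ≡φ

  _⊕⟨_,_⟩ : (B : FinStr k) → Lab k → (Fin (size B) → Lab k) → FinStr k
  B ⊕⟨ u , ρ ⟩ = finStr (suc (size B)) U⊕ R⊕
    where
    U⊕ : Fin (suc (size B)) → Lab k
    U⊕ fzero = u
    U⊕ (fsuc b) = U B b
    R⊕ : Fin (suc (size B)) → Fin (suc (size B)) → Lab k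
    R⊕ fzero fzero = fzero
    R⊕ fzero (fsuc b) = ρ b
    R⊕ (fsuc b) fzero = Flip (ρ b)
    R⊕ (fsuc b) (fsuc b') = R B b b'

  ⊕-wf : ∀ B u ρ → WF Flip B → WF Flip (B ⊕⟨ u , ρ ⟩)
  ⊕-wf B u ρ (B-diag , B-flip) = diag , flip
    where
    diag : ∀ a → R (B ⊕⟨ u , ρ ⟩) a a ≡ fzero
    diag fzero = refl
    diag (fsuc b) = B-diag b
    flip : ∀ a b → R (B ⊕⟨ u , ρ ⟩) b a ≡ Flip (R (B ⊕⟨ u , ρ ⟩) a b)
    flip fzero fzero = sym flip0
    flip fzero (fsuc b) = refl
    flip (fsuc b) fzero = sym (flip-involutive (ρ b))
    flip (fsuc a) (fsuc b) = B-flip a b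

  label⊕ : ∀ {n} → Node k → (Fin n → Node k) → Fin (suc n) → Node k
  label⊕ c φ fzero = c
  label⊕ c φ (fsuc b) = φ b

  update : (ℕ → ℕ) → ℕ → ℕ → ℕ → ℕ
  update P m x i with i ≟ m
  ... | yes _ = x
  ... | no _ = P i

  update-here : ∀ P m x → update P m x m ≡ x
  update-here P m x with m ≟ m
  ... | yes _ = refl
  ... | no m≢m = ⊥-elim (m≢m refl)

  update-below : ∀ P m x i → i < m → update P m x i ≡ P i
  update-below P m x i i<m with i ≟ m
  ... | yes refl = ⊥-elim (<-irrefl refl i<m)
  ... | no _ = refl

  -- Realising (B, φ) over P 0, …, P m is realising B ⊕⟨ U(P m) , φ(·)(m) ⟩ over P 0, …, P (m-1),
  -- the new point being labeled c = the type of P m over the others.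
  module _ (m : ℕ) (P : ℕ → ℕ) (B : FinStr k) (φ : Fin (size B) → Node k) (u : Lab k) (ρ : Fin (size B) → Lab k)
           (c : Node k) (φ' : Fin (size B) → Node k)
           (ρ≡φm : ∀ b → ρ b ≡ nth (φ b) m) (u≡UPm : u ≡ UK (P m)) (c≡RPm : ∀ i → i < m → nth c i ≡ RK (P i) (P m))
           (φ'≡φ : ∀ b i → i < m → nth (φ' b) i ≡ nth (φ b) i) where

    realisation-absorb : (∀ i → i < m → P i ≢ P m) → Realised (suc m) P B φ → Realised m P (B ⊕⟨ u , ρ ⟩) (label⊕ c φ')
    realisation-absorb Pm-new (ι , ι-inj , ι-avoids , ι-U , ι-R , ι-labels) = ι⊕ , inj⊕ , avoids⊕ , U⊕ , R⊕ , labels⊕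
      where
      ι⊕ : Fin (suc (size B)) → ℕ
      ι⊕ fzero = P m
      ι⊕ (fsuc b) = ι b
      inj⊕ : ∀ a a' → ι⊕ a ≡ ι⊕ a' → a ≡ a'
      inj⊕ fzero fzero q = refl
      inj⊕ fzero (fsuc b) q = ⊥-elim (ι-avoids b m ≤-refl (sym q))
      inj⊕ (fsuc b) fzero q = ⊥-elim (ι-avoids b m ≤-refl q)
      inj⊕ (fsuc b) (fsuc b') q = cong fsuc (ι-inj b b' q)
      avoids⊕ : ∀ a i → i < m → ι⊕ a ≢ P i
      avoids⊕ fzero i i<m q = Pm-new i i<m (sym q)
      avoids⊕ (fsuc b) i i<m = ι-avoids b i (m≤n⇒m≤1+n i<m)
      U⊕ : ∀ a → UK (ι⊕ a) ≡ U (B ⊕⟨ u , ρ ⟩) a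
      U⊕ fzero = sym u≡UPm
      U⊕ (fsuc b) = ι-U b
      R⊕ : ∀ a a' → RK (ι⊕ a) (ι⊕ a') ≡ R (B ⊕⟨ u , ρ ⟩) a a'
      R⊕ fzero fzero = RK-diag _
      R⊕ fzero (fsuc b) = trans (ι-labels b m ≤-refl) (sym (ρ≡φm b))
      R⊕ (fsuc b) fzero = trans (RK-flip _ _) (cong Flip (trans (ι-labels b m ≤-refl) (sym (ρ≡φm b))))
      R⊕ (fsuc b) (fsuc b') = ι-R b b'
      labels⊕ : ∀ a i → i < m → RK (P i) (ι⊕ a) ≡ nth (label⊕ c φ' a) i
      labels⊕ fzero i i<m = sym (c≡RPm i i<m)
      labels⊕ (fsuc b) i i<m = trans (ι-labels b i (m≤n⇒m≤1+n i<m)) (sym (φ'≡φ b i i<m))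

    -- conversely the new point x of a realisation of B ⊕⟨ u , ρ ⟩ is a copy of P m over P 0, …, P (m-1),
    -- so P[m ≔ x] ≅ P and the realisation moves to P
    realisation-emit : InjectiveBelow (suc m) P → Realised m P (B ⊕⟨ u , ρ ⟩) (label⊕ c φ') → Realised (suc m) P B φ
    realisation-emit P-inj (ι⊕ , inj⊕ , avoids⊕ , U⊕ , R⊕ , labels⊕) =
      realisation-move (suc m) P' P P'≅P-R P'≅P-U P'-inj P-inj B φ realised'
      where
      x = ι⊕ fzero
      P' = update P m x
      x-over-P : ∀ i → i < m → RK (P i) x ≡ RK (P i) (P m)
      x-over-P i i<m = trans (labels⊕ fzero i i<m) (c≡RPm i i<m)
      realised' : Realised (suc m) P' B φ
      realised' = ι⊕ ∘ fsuc , (λ b b' q → fsuc-injective (inj⊕ _ _ q)) , avoids , (λ b → U⊕ (fsuc b)) ,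
                  (λ b b' → R⊕ (fsuc b) (fsuc b')) , labels
        where
        avoids : ∀ b i → i < suc m → ι⊕ (fsuc b) ≢ P' i
        avoids b i i<1+m q with m<1+n⇒m<n∨m≡n i<1+m
        ... | inj₁ i<m = avoids⊕ (fsuc b) i i<m (trans q (update-below P m x i i<m))
        ... | inj₂ refl with inj⊕ (fsuc b) fzero (trans q (update-here P m x))
        ... | ()
        labels : ∀ b i → i < suc m → RK (P' i) (ι⊕ (fsuc b)) ≡ nth (φ b) i
        labels b i i<1+m with m<1+n⇒m<n∨m≡n i<1+m
        ... | inj₁ i<m = trans (cong (λ z → RK z (ι⊕ (fsuc b))) (update-below P m x i i<m))
                               (trans (labels⊕ (fsuc b) i i<m) (φ'≡φ b i i<m))
        ... | inj₂ refl = trans (cong (λ z → RK z (ι⊕ (fsuc b))) (update-here P m x)) (trans (R⊕ fzero (fsuc b)) (ρ≡φm b))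
      P'≅P-R : ∀ i j → i < suc m → j < suc m → RK (P' i) (P' j) ≡ RK (P i) (P j)
      P'≅P-R i j i< j< with m<1+n⇒m<n∨m≡n i< | m<1+n⇒m<n∨m≡n j<
      ... | inj₁ i<m | inj₁ j<m = cong₂ RK (update-below P m x i i<m) (update-below P m x j j<m)
      ... | inj₁ i<m | inj₂ refl = trans (cong₂ RK (update-below P m x i i<m) (update-here P m x)) (x-over-P i i<m)
      ... | inj₂ refl | inj₁ j<m = trans (cong₂ RK (update-here P m x) (update-below P m x j j<m))
                                     (trans (RK-flip _ _) (trans (cong Flip (x-over-P j j<m)) (sym (RK-flip _ _))))
      ... | inj₂ refl | inj₂ refl = trans (cong₂ RK (update-here P m x) (update-here P m x)) (trans (RK-diag _) (sym (RK-diag _)))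
      P'≅P-U : ∀ i → i < suc m → UK (P' i) ≡ UK (P i)
      P'≅P-U i i< with m<1+n⇒m<n∨m≡n i<
      ... | inj₁ i<m = cong UK (update-below P m x i i<m)
      ... | inj₂ refl = trans (cong UK (update-here P m x)) (trans (U⊕ fzero) u≡UPm)
      P'-inj : InjectiveBelow (suc m) P'
      P'-inj i j i< j< e with m<1+n⇒m<n∨m≡n i< | m<1+n⇒m<n∨m≡n j<
      ... | inj₁ i<m | inj₁ j<m = P-inj i j i< j< (trans (sym (update-below P m x i i<m)) (trans e (update-below P m x j j<m)))
      ... | inj₁ i<m | inj₂ refl = ⊥-elim (avoids⊕ fzero i i<m (sym (trans (sym (update-below P m x i i<m)) (trans e (update-here P m x)))))
      ... | inj₂ refl | inj₁ j<m = ⊥-elim (avoids⊕ fzero j j<m (trans (sym (update-here P m x)) (trans e (update-below P m x j j<m))))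
      ... | inj₂ refl | inj₂ refl = refl

  CopiedOr0 : (Node k → Set) → ℕ → Node k → Set
  CopiedOr0 Q p u = (Σ (Node k) λ w → Q w × (∀ i → i ≤ p → nth u i ≡ nth w i)) ⊎ nth u p ≡ fzero

  -- Let p be a level at which every Q-labeled structure B' with
  -- B'[φ'|p, K] ∈ 𝒦 satisfies B'[φ', K] ∈ 𝒦 (the restriction map on Q is an age map), and let
  -- (B, F) be such that each F b is CopiedOr0 at p.  Then a realisation of (B, F) over K_p extends
  -- to one over K_{p+1}: for the copied part B' of B, labeled by the nodes w it copies, the
  -- hypothesis gives B'[w, K] ∈ 𝒦, and a free amalgam of B[F|p, K] and B'[w, K] over B'[w|p, K]
  -- contains B[F, K], the point p being unrelated to the rest of B by freeness.
  module AmalgamationStep (amalgamate : FreeAmalgamation 𝒦) (p : ℕ) (Q : Node k → Set)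
    (p-aged : ∀ (B' : FinStr k) → WF Flip B' → (φ' : Fin (size B') → Node k) → (∀ b → Q (φ' b)) →
              𝒦 (Glue Flip p K B' (λ b → take p (φ' b))) → 𝒦 (Glue Flip (suc p) K B' φ'))
    (B : FinStr k) (B-wf : WF Flip B) (F : Fin (size B) → Node k)
    (copied-or-0 : ∀ b → CopiedOr0 Q p (F b)) where

    private
      n = size B

    Copied : Fin n → Set
    Copied b = ∃[ w ] copied-or-0 b ≡ inj₁ w

    Copied? : ∀ b → Dec (Copied b)
    Copied? b with copied-or-0 b
    ... | inj₁ w = yes (w , refl)
    ... | inj₂ _ = no λ { (_ , ()) }

    not-copied : ∀ b → ¬ Copied b → nth (F b) p ≡ fzero
    not-copied b ¬copied with copied-or-0 b
    ... | inj₁ w = ⊥-elim (¬copied (w , refl))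
    ... | inj₂ z = z

    open Selection (select n Copied Copied?) renaming (count to n')

    B' : FinStr k
    B' = finStr n' (U B ∘ embed) (λ y y' → R B (embed y) (embed y'))

    B'-wf : WF Flip B'
    B'-wf = (λ y → proj₁ B-wf (embed y)) , (λ y y' → proj₂ B-wf (embed y) (embed y'))

    copy : ∀ y → Σ (Node k) λ w → Q w × (∀ i → i ≤ p → nth (F (embed y)) i ≡ nth w i)
    copy y = proj₁ (sound y)

    w : Fin n' → Node k
    w y = proj₁ (copy y)

    w-agrees : ∀ y i → i ≤ p → nth (F (embed y)) i ≡ nth (w y) i
    w-agrees y = proj₂ (proj₂ (copy y))

    -- the amalgamation problem: Base ↪ Old (by B' ⊆ B) and Base ↪ New (by K_p ⊆ K_{p+1})
    Base Old New Target : FinStr k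
    Base = Glue Flip p K B' (λ y → take p (w y))
    Old = Glue Flip p K B F
    New = Glue Flip (suc p) K B' w
    Target = Glue Flip (suc p) K B F

    w|p≡F : ∀ y j → j < p → nth (take p (w y)) j ≡ nth (F (embed y)) j
    w|p≡F y j j<p = trans (nth-take (w y) p j j<p) (sym (w-agrees y j (<⇒≤ j<p)))

    base→old : Fin (p + n') → Fin (p + n)
    base→old x = either (_↑ˡ n) (λ y → p ↑ʳ embed y) (splitAt p x)

    base→oldˡ : ∀ j → base→old (j ↑ˡ n') ≡ j ↑ˡ n
    base→oldˡ j rewrite splitAt-↑ˡ p j n' = refl

    base→oldʳ : ∀ y → base→old (p ↑ʳ y) ≡ p ↑ʳ embed y
    base→oldʳ y rewrite splitAt-↑ʳ p n' y = refl

    base↪old : IsEmb Base Old base→old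
    base↪old = glue-embedding Flip p K B' (λ y → take p (w y)) (U Old) (R Old) base→old
      (λ i j q → ↑ˡ-injective n i j (trans (sym (base→oldˡ i)) (trans q (base→oldˡ j))))
      (λ y y' q → embed-injective y y' (↑ʳ-injective p _ _ (trans (sym (base→oldʳ y)) (trans q (base→oldʳ y')))))
      (λ i y q → ↑ˡ≢↑ʳ i (embed y) (trans (sym (base→oldˡ i)) (trans q (base→oldʳ y))))
      (λ i → trans (cong (U Old) (base→oldˡ i)) (glue-Uˡ Flip p K B F i))
      (λ y → trans (cong (U Old) (base→oldʳ y)) (glue-Uʳ Flip p K B F (embed y)))
      (λ i j → trans (cong₂ (R Old) (base→oldˡ i) (base→oldˡ j)) (glue-Rˡˡ Flip p K B F i j))
      (λ i y → trans (cong₂ (R Old) (base→oldˡ i) (base→oldʳ y))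
                     (trans (glue-Rˡʳ Flip p K B F i (embed y)) (sym (w|p≡F y (toℕ i) (toℕ<n i)))))
      (λ y i → trans (cong₂ (R Old) (base→oldʳ y) (base→oldˡ i))
                     (trans (glue-Rʳˡ Flip p K B F (embed y) i) (cong Flip (sym (w|p≡F y (toℕ i) (toℕ<n i))))))
      (λ y y' → trans (cong₂ (R Old) (base→oldʳ y) (base→oldʳ y')) (glue-Rʳʳ Flip p K B F (embed y) (embed y')))

    base→new : Fin (p + n') → Fin (suc p + n')
    base→new x = either (λ j → inject₁ j ↑ˡ n') (λ y → suc p ↑ʳ y) (splitAt p x)

    base→newˡ : ∀ j → base→new (j ↑ˡ n') ≡ inject₁ j ↑ˡ n'
    base→newˡ j rewrite splitAt-↑ˡ p j n' = refl

    base→newʳ : ∀ y → base→new (p ↑ʳ y) ≡ suc p ↑ʳ y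
    base→newʳ y rewrite splitAt-↑ʳ p n' y = refl

    w-inject : ∀ y j → nth (w y) (toℕ (inject₁ j)) ≡ nth (take p (w y)) (toℕ j)
    w-inject y j = trans (cong (nth (w y)) (toℕ-inject₁ j)) (sym (nth-take (w y) p (toℕ j) (toℕ<n j)))

    base↪new : IsEmb Base New base→new
    base↪new = glue-embedding Flip p K B' (λ y → take p (w y)) (U New) (R New) base→new
      (λ i j q → inject₁-injective (↑ˡ-injective n' _ _ (trans (sym (base→newˡ i)) (trans q (base→newˡ j)))))
      (λ y y' q → ↑ʳ-injective (suc p) _ _ (trans (sym (base→newʳ y)) (trans q (base→newʳ y'))))
      (λ i y q → ↑ˡ≢↑ʳ (inject₁ i) y (trans (sym (base→newˡ i)) (trans q (base→newʳ y))))
      (λ i → trans (cong (U New) (base→newˡ i)) (trans (glue-Uˡ Flip (suc p) K B' w (inject₁ i)) (cong UK (toℕ-inject₁ i))))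
      (λ y → trans (cong (U New) (base→newʳ y)) (glue-Uʳ Flip (suc p) K B' w y))
      (λ i j → trans (cong₂ (R New) (base→newˡ i) (base→newˡ j))
                     (trans (glue-Rˡˡ Flip (suc p) K B' w _ _) (cong₂ RK (toℕ-inject₁ i) (toℕ-inject₁ j))))
      (λ i y → trans (cong₂ (R New) (base→newˡ i) (base→newʳ y)) (trans (glue-Rˡʳ Flip (suc p) K B' w _ y) (w-inject y i)))
      (λ y i → trans (cong₂ (R New) (base→newʳ y) (base→newˡ i))
                     (trans (glue-Rʳˡ Flip (suc p) K B' w y _) (cong Flip (w-inject y i))))
      (λ y y' → trans (cong₂ (R New) (base→newʳ y) (base→newʳ y')) (glue-Rʳʳ Flip (suc p) K B' w y y'))

    p-new : ∀ a → base→new a ≢ fromℕ p ↑ˡ n'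
    p-new a q with split-view {p} {n'} a
    ... | inj₁ (j , refl) = fromℕ≢inject₁ (sym (↑ˡ-injective n' _ _ (trans (sym (base→newˡ j)) q)))
    ... | inj₂ (y , refl) = ↑ˡ≢↑ʳ (fromℕ p) y (sym (trans (sym (base→newʳ y)) q))

    -- Target = B[F, K_{p+1}] embeds into any free amalgam D of Old and New over Base:
    -- K_p and B are sent through Old, the point p through New.
    module FromAmalgam (D : FinStr k) (r : Fin (size Old) → Fin (size D)) (s : Fin (size New) → Fin (size D))
      (𝒦D : 𝒦 D) (r-emb : IsEmb Old D r) (s-emb : IsEmb New D s)
      (commutes : ∀ a → r (base→old a) ≡ s (base→new a))
      (overlap-in-base : ∀ b c → r b ≡ s c → ∃[ a ] r (base→old a) ≡ r b)
      (free : ∀ d d' → R D d d' ≢ fzero →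
              ((∃[ b ] r b ≡ d) × (∃[ b ] r b ≡ d')) ⊎ ((∃[ c ] s c ≡ d) × (∃[ c ] s c ≡ d'))) where

      private
        r-inj = proj₁ r-emb
        r-U = proj₁ (proj₂ r-emb)
        r-R = proj₂ (proj₂ r-emb)
        s-inj = proj₁ s-emb
        s-U = proj₁ (proj₂ s-emb)
        s-R = proj₂ (proj₂ s-emb)

      pᴰ : Fin (size D)
      pᴰ = s (fromℕ p ↑ˡ n')

      pᴰ-new : ∀ x → r x ≢ pᴰ
      pᴰ-new x q with overlap-in-base x _ q
      ... | a , ra = p-new a (s-inj _ _ (trans (sym (commutes a)) (trans ra q)))

      Kᴰ : Fin (suc p) → Fin (size D)
      Kᴰ i with toℕ i <? p
      ... | yes i<p = r (fromℕ< i<p ↑ˡ n)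
      ... | no _ = pᴰ

      Kᴰ-old : ∀ j → Kᴰ (inject₁ j) ≡ r (j ↑ˡ n)
      Kᴰ-old j with toℕ (inject₁ j) <? p
      ... | yes j<p = cong r (cong (_↑ˡ n) (toℕ-injective (trans (toℕ-fromℕ< j<p) (toℕ-inject₁ j))))
      ... | no j≮p = ⊥-elim (j≮p (subst (_< p) (sym (toℕ-inject₁ j)) (toℕ<n j)))

      Kᴰ-new : Kᴰ (fromℕ p) ≡ pᴰ
      Kᴰ-new with toℕ (fromℕ p) <? p
      ... | yes p<p = ⊥-elim (<-irrefl (toℕ-fromℕ p) p<p)
      ... | no _ = refl

      Kᴰ-in-new : ∀ i → Kᴰ i ≡ s (i ↑ˡ n')
      Kᴰ-in-new i with last-view i
      ... | inj₁ (j , refl) = trans (Kᴰ-old j) (trans (cong r (sym (base→oldˡ j))) (trans (commutes (j ↑ˡ n')) (cong s (base→newˡ j))))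
      ... | inj₂ refl = Kᴰ-new

      copied-in-new : ∀ y → r (p ↑ʳ embed y) ≡ s (suc p ↑ʳ y)
      copied-in-new y = trans (cong r (sym (base→oldʳ y))) (trans (commutes (p ↑ʳ y)) (cong s (base→newʳ y)))

      in-new⇒copied : ∀ b c → s c ≡ r (p ↑ʳ b) → Copied b
      in-new⇒copied b c q with overlap-in-base (p ↑ʳ b) c (sym q)
      ... | a , ra with split-view {p} {n'} a
      ... | inj₁ (j , refl) = ⊥-elim (↑ˡ≢↑ʳ j b (trans (sym (base→oldˡ j)) (r-inj _ _ ra)))
      ... | inj₂ (y , refl) = subst Copied (↑ʳ-injective p _ _ (trans (sym (base→oldʳ y)) (r-inj _ _ ra))) (sound y)

      -- freeness: the new point is unrelated to points of B that are not copied
      free-from-new : ∀ b → ¬ Copied b → R D pᴰ (r (p ↑ʳ b)) ≡ fzero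
      free-from-new b ¬copied with R D pᴰ (r (p ↑ʳ b)) ≟F fzero
      ... | yes z = z
      ... | no nz with free _ _ nz
      ... | inj₁ ((x , q) , _) = ⊥-elim (pᴰ-new x q)
      ... | inj₂ (_ , (c , q)) = ⊥-elim (¬copied (in-new⇒copied b c q))

      e : Fin (suc p + n) → Fin (size D)
      e x = either Kᴰ (λ b → r (p ↑ʳ b)) (splitAt (suc p) x)

      eˡ : ∀ i → e (i ↑ˡ n) ≡ Kᴰ i
      eˡ i rewrite splitAt-↑ˡ (suc p) i n = refl

      eʳ : ∀ b → e (suc p ↑ʳ b) ≡ r (p ↑ʳ b)
      eʳ b rewrite splitAt-↑ʳ (suc p) n b = refl

      Kᴰ-injective : ∀ i j → Kᴰ i ≡ Kᴰ j → i ≡ j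
      Kᴰ-injective i j q = ↑ˡ-injective n' i j (s-inj _ _ (trans (sym (Kᴰ-in-new i)) (trans q (Kᴰ-in-new j))))

      Kᴰ-apart : ∀ i b → Kᴰ i ≢ r (p ↑ʳ b)
      Kᴰ-apart i b q with last-view i
      ... | inj₁ (j , refl) = ↑ˡ≢↑ʳ j b (r-inj _ _ (trans (sym (Kᴰ-old j)) q))
      ... | inj₂ refl = pᴰ-new _ (sym (trans (sym Kᴰ-new) q))

      Kᴰ-U : ∀ i → U D (Kᴰ i) ≡ UK (toℕ i)
      Kᴰ-U i = trans (cong (U D) (Kᴰ-in-new i)) (trans (s-U _) (glue-Uˡ Flip (suc p) K B' w i))

      Kᴰ-R : ∀ i j → R D (Kᴰ i) (Kᴰ j) ≡ RK (toℕ i) (toℕ j)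
      Kᴰ-R i j = trans (cong₂ (R D) (Kᴰ-in-new i) (Kᴰ-in-new j)) (trans (s-R _ _) (glue-Rˡˡ Flip (suc p) K B' w i j))

      -- the relation between the point p and b is F b (p): read off New for copied b, 0 otherwise
      new-to-B : ∀ b → R D pᴰ (r (p ↑ʳ b)) ≡ nth (F b) p
      new-to-B b with Copied? b
      ... | no ¬copied = trans (free-from-new b ¬copied) (sym (not-copied b ¬copied))
      ... | yes copied with complete b copied
      ... | y , refl = begin
        R D pᴰ (r (p ↑ʳ embed y))               ≡⟨ cong (R D pᴰ) (copied-in-new y) ⟩
        R D pᴰ (s (suc p ↑ʳ y))                 ≡⟨ s-R _ _ ⟩
        R New (fromℕ p ↑ˡ n') (suc p ↑ʳ y)      ≡⟨ glue-Rˡʳ Flip (suc p) K B' w (fromℕ p) y ⟩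
        nth (w y) (toℕ (fromℕ p))               ≡⟨ cong (nth (w y)) (toℕ-fromℕ p) ⟩
        nth (w y) p                             ≡⟨ sym (w-agrees y p ≤-refl) ⟩
        nth (F (embed y)) p                     ∎
        where open ≡-Reasoning

      K-to-B : ∀ i b → R D (Kᴰ i) (r (p ↑ʳ b)) ≡ nth (F b) (toℕ i)
      K-to-B i b with last-view i
      ... | inj₁ (j , refl) = trans (cong (λ z → R D z (r (p ↑ʳ b))) (Kᴰ-old j))
                                (trans (r-R _ _) (trans (glue-Rˡʳ Flip p K B F j b) (cong (nth (F b)) (sym (toℕ-inject₁ j)))))
      ... | inj₂ refl = trans (cong (λ z → R D z (r (p ↑ʳ b))) Kᴰ-new)
                              (trans (new-to-B b) (cong (nth (F b)) (sym (toℕ-fromℕ p))))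

      target↪D : IsEmb Target D e
      target↪D = glue-embedding Flip (suc p) K B F (U D) (R D) e
        (λ i j q → Kᴰ-injective i j (trans (sym (eˡ i)) (trans q (eˡ j))))
        (λ b b' q → ↑ʳ-injective p _ _ (r-inj _ _ (trans (sym (eʳ b)) (trans q (eʳ b')))))
        (λ i b q → Kᴰ-apart i b (trans (sym (eˡ i)) (trans q (eʳ b))))
        (λ i → trans (cong (U D) (eˡ i)) (Kᴰ-U i))
        (λ b → trans (cong (U D) (eʳ b)) (trans (r-U _) (glue-Uʳ Flip p K B F b)))
        (λ i j → trans (cong₂ (R D) (eˡ i) (eˡ j)) (Kᴰ-R i j))
        (λ i b → trans (cong₂ (R D) (eˡ i) (eʳ b)) (K-to-B i b))
        (λ b i → trans (cong₂ (R D) (eʳ b) (eˡ i)) (trans (𝒦-flip D 𝒦D _ _) (cong Flip (K-to-B i b))))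
        (λ b b' → trans (cong₂ (R D) (eʳ b) (eʳ b')) (trans (r-R _ _) (glue-Rʳʳ Flip p K B F b b')))

    -- Old ∈ 𝒦 by the realisation, Base ⊆ Old, New ∈ 𝒦 by p-aged; Target embeds into their amalgam
    realisation-step : Realised p id B F → Realised (suc p) id B F
    realisation-step realised = glue⇒realisation K (suc p) id (copies-id (suc p)) B F 𝒦Target
      where
      𝒦Old : 𝒦 Old
      𝒦Old = realisation⇒glue K p id (copies-id p) B F realised
      𝒦Base : 𝒦 Base
      𝒦Base = 𝒦-hereditary Base Old base→old base↪old 𝒦Old
      𝒦New : 𝒦 New
      𝒦New = p-aged B' B'-wf w (λ y → proj₁ (proj₂ (copy y))) 𝒦Base
      𝒦Target : 𝒦 Target
      𝒦Target with amalgamate Base Old New base→old base→new 𝒦Base 𝒦Old 𝒦New base↪old base↪new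
      ... | D , r , s , 𝒦D , r-emb , s-emb , commutes , _ , shared , free =
        𝒦-hereditary Target D e target↪D 𝒦D
        where open FromAmalgam D r s 𝒦D r-emb s-emb commutes shared free

  module EnumeratedS (s : List ℕ) (s-sorted : AllPairs _<_ s) where
    open Increasing s s-sorted public

    A : EnumStr k
    A = subStr K s

    copies-S : ∀ m → m ≤ N → Copies A m S
    copies-S m m≤N = (λ _ _ _ _ → refl) , (λ _ _ → refl) ,
                     (λ i j i<m j<m e → S-injective i j (<-≤-trans i<m m≤N) (<-≤-trans j<m m≤N) e)

  module Forward (s : List ℕ) (s-sorted : AllPairs _<_ s) (f : Node k → Node k) (f-aemb : IsAEmbS Flip 𝒦 K s f) where
    open EnumeratedS s s-sorted

    private
      f-levels = proj₁ (proj₂ f-aemb)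
      f-meets = proj₁ (proj₂ (proj₂ f-aemb))
      f-extends = proj₁ (proj₂ (proj₂ (proj₂ f-aemb)))
      f-codes = proj₁ (proj₂ (proj₂ (proj₂ (proj₂ f-aemb))))
      f-aged = proj₂ (proj₂ (proj₂ (proj₂ (proj₂ f-aemb))))

    -- f is monotone for ⊑ (from f(x⌢i) ⊒ f(x)⌢i)
    f-prefix : ∀ (z y : Node k) → length (y ++ z) < N → f y ⊑ f (y ++ z)
    f-prefix [] y _ = [] , trans (++-identityʳ (f y)) (cong f (sym (++-identityʳ y)))
    f-prefix (a ∷ z) y ya+z<N =
      ⊑-trans (⊑-snoc (f-extends y a ya<N)) (subst (λ v → f (y ++ [ a ]) ⊑ f v) (++-assoc y [ a ] z) (f-prefix z (y ++ [ a ]) ya+z<N'))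
      where
      ya+z<N' : length ((y ++ [ a ]) ++ z) < N
      ya+z<N' = subst (λ v → length v < N) (sym (++-assoc y [ a ] z)) ya+z<N
      ya<N : length (y ++ [ a ]) < N
      ya<N = ≤-<-trans (≤-trans (m≤m+n _ (length z)) (≤-reflexive (sym (length-++ (y ++ [ a ]) {z})))) ya+z<N'

    f-take : ∀ j x → j ≤ length x → length x < N → f (take j x) ≡ take (S j) (f x)
    f-take j x j≤ x<N = sym (trans (cong (λ l → take l (f x)) (sym length-f)) (⊑-take prefix))
      where
      prefix : f (take j x) ⊑ f x
      prefix = subst (λ v → f (take j x) ⊑ f v) (take++drop≡id j x)
                 (f-prefix (drop j x) (take j x) (subst (λ v → length v < N) (sym (take++drop≡id j x)) x<N))
      length-f : length (f (take j x)) ≡ S j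
      length-f = f-levels j (take j x) (≤-<-trans j≤ x<N) (length-take≤ x j j≤)

    -- (1): ℓ(c(S i) ∧ c(S j)) = S ℓ(c^A(i) ∧ c^A(j)) since f maps coding nodes to coding nodes and preserves meets
    cond1 : Cond1 K s
    cond1 m n m∈s n∈s with ∈⇒index m m∈s | ∈⇒index n n∈s
    ... | i , i<N , refl | j , j<N , refl = subst (_∈ s) (sym length-meet) (index⇒∈ q q<N)
      where
      cᵢ = code A i
      cⱼ = code A j
      q = length (meet cᵢ cⱼ)
      q<N : q < N
      q<N = ≤-<-trans (subst (q ≤_) (length-code A i) (meet-length≤ˡ cᵢ cⱼ)) i<N
      length-meet : length (meet (code K (S i)) (code K (S j))) ≡ S q
      length-meet = begin
        length (meet (code K (S i)) (code K (S j))) ≡⟨ cong length (cong₂ meet (sym (proj₁ (f-codes i i<N))) (sym (proj₁ (f-codes j j<N)))) ⟩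
        length (meet (f cᵢ) (f cⱼ))                 ≡⟨ cong length (sym (f-meets cᵢ cⱼ (subst (_< N) (sym (length-code A i)) i<N)
                                                                                          (subst (_< N) (sym (length-code A j)) j<N))) ⟩
        length (f (meet cᵢ cⱼ))                     ≡⟨ f-levels q (meet cᵢ cⱼ) q<N refl ⟩
        S q                                         ∎
        where open ≡-Reasoning

    -- Restricting a
    -- realisation over K_{m+1} to K_m is trivial; conversely, let ℓ be the least index with
    -- m < S ℓ.  A labeled structure over c[S]|_{m+1} realised over K_m is realised over the
    -- points S 0 < … < S (ℓ-1) < m, i.e. lies in 𝒞^{K_S}(ℓ); as f is aged it lies in 𝒞(S ℓ) after
    -- applying f, and f(c^{K_S}(i)|ℓ) = c(S i)|S ℓ extends the given labels since m < S ℓ.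
    module Restriction (m : ℕ) (m≤max : ∃[ a ] (a ∈ s × m ≤ a)) (m∉s : ¬ (m ∈ s)) where

      private
        i₀ = proj₁ (∈⇒index _ (proj₁ (proj₂ m≤max)))
        i₀<N = proj₁ (proj₂ (∈⇒index _ (proj₁ (proj₂ m≤max))))
        Si₀≡a₀ = proj₂ (proj₂ (∈⇒index _ (proj₁ (proj₂ m≤max))))
        m<Si₀ : m < S i₀
        m<Si₀ = ≤∧≢⇒< (subst (m ≤_) (sym Si₀≡a₀) (proj₂ (proj₂ m≤max)))
                      (λ m≡ → m∉s (subst (_∈ s) (sym m≡) (index⇒∈ i₀ i₀<N)))
        least = least-below (λ i → m <? S i) N (i₀ , i₀<N , m<Si₀)

      ℓ : ℕ
      ℓ = proj₁ least

      ℓ<N : ℓ < N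
      ℓ<N = proj₁ (proj₂ least)

      m<Sℓ : m < S ℓ
      m<Sℓ = proj₁ (proj₂ (proj₂ least))

      S<m : ∀ i → i < ℓ → S i < m
      S<m i i<ℓ = ≤∧≢⇒< (≮⇒≥ (proj₂ (proj₂ (proj₂ least)) i i<ℓ))
                        (λ e → m∉s (subst (_∈ s) e (index⇒∈ i (<-trans i<ℓ ℓ<N))))

      module _ (B : FinStr k) (B-wf : WF Flip B) (φ : Fin (size B) → Node k) (φ∈ : ∀ b → CSrestr K s m (φ b)) where

        index : ∀ b → InS (proj₁ (φ∈ b))
        index b = ∈⇒index _ (proj₁ (proj₂ (φ∈ b)))

        ι : Fin (size B) → ℕ
        ι b = proj₁ (index b)

        ι<N : ∀ b → ι b < N
        ι<N b = proj₁ (proj₂ (index b))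

        φ≡ : ∀ b → φ b ≡ take (suc m) (code K (S (ι b)))
        φ≡ b = trans (proj₂ (proj₂ (proj₂ (φ∈ b)))) (cong (λ z → take (suc m) (code K z)) (sym (proj₂ (proj₂ (index b)))))

        m<Sι : ∀ b → suc m ≤ S (ι b)
        m<Sι b = subst (suc m ≤_) (sym (proj₂ (proj₂ (index b)))) (proj₁ (proj₂ (proj₂ (φ∈ b))))

        ℓ≤ι : ∀ b → ℓ ≤ ι b
        ℓ≤ι b = ≮⇒≥ λ ι<ℓ → proj₂ (proj₂ (proj₂ least)) (ι b) ι<ℓ (m<Sι b)

        w : Fin (size B) → Node k
        w b = take ℓ (code A (ι b))

        w-length : ∀ b → length (w b) ≡ ℓ
        w-length b = length-take-code A (ι b) ℓ (ℓ≤ι b)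

        f-w : ∀ b → f (w b) ≡ take (S ℓ) (code K (S (ι b)))
        f-w b = trans (f-take ℓ (code A (ι b)) (subst (ℓ ≤_) (sym (length-code A (ι b))) (ℓ≤ι b))
                                (subst (_< N) (sym (length-code A (ι b))) (ι<N b)))
                      (cong (take (S ℓ)) (proj₁ (f-codes (ι b) (ι<N b))))

        w-reads-φ : ∀ b i → i < ℓ → nth (w b) i ≡ nth (take m (φ b)) (S i)
        w-reads-φ b i i<ℓ = begin
          nth (w b) i                                     ≡⟨ nth-take (code A (ι b)) ℓ i i<ℓ ⟩
          nth (code A (ι b)) i                            ≡⟨ nth-code A (ι b) i (<-≤-trans i<ℓ (ℓ≤ι b)) ⟩
          RK (S i) (S (ι b))                              ≡⟨ sym (nth-code K (S (ι b)) (S i) (S-mono i (ι b) (<-≤-trans i<ℓ (ℓ≤ι b)) (ι<N b))) ⟩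
          nth (code K (S (ι b))) (S i)                    ≡⟨ sym (nth-take (code K (S (ι b))) (suc m) (S i) (m≤n⇒m≤1+n (S<m i i<ℓ))) ⟩
          nth (take (suc m) (code K (S (ι b)))) (S i)     ≡⟨ cong (λ z → nth z (S i)) (sym (φ≡ b)) ⟩
          nth (φ b) (S i)                                 ≡⟨ sym (nth-take (φ b) m (S i) (S<m i i<ℓ)) ⟩
          nth (take m (φ b)) (S i)                        ∎
          where open ≡-Reasoning

        φ-reads-fw : ∀ b i → i < suc m → nth (φ b) i ≡ nth (f (w b)) i
        φ-reads-fw b i i≤m = begin
          nth (φ b) i                                     ≡⟨ cong (λ z → nth z i) (φ≡ b) ⟩
          nth (take (suc m) (code K (S (ι b)))) i         ≡⟨ nth-take (code K (S (ι b))) (suc m) i i≤m ⟩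
          nth (code K (S (ι b))) i                        ≡⟨ sym (nth-take (code K (S (ι b))) (S ℓ) i (<-≤-trans i≤m m<Sℓ)) ⟩
          nth (take (S ℓ) (code K (S (ι b)))) i           ≡⟨ cong (λ z → nth z i) (sym (f-w b)) ⟩
          nth (f (w b)) i                                 ∎
          where open ≡-Reasoning

        pull-back : 𝒞 Flip 𝒦 K m B (λ b → take m (φ b)) → 𝒞 Flip 𝒦 K (suc m) B φ
        pull-back (_ , 𝒦Glue) = φ-length , realisation⇒glue K (suc m) id (copies-id (suc m)) B φ over-m+1
          where
          φ-length : ∀ b → length (φ b) ≡ suc m
          φ-length b = trans (cong length (φ≡ b)) (length-take-code K (S (ι b)) (suc m) (m<Sι b))
          over-S<m : Realised ℓ S B w
          over-S<m = realisation-restrict m id B (λ b → take m (φ b)) (glue⇒realisation K m id (copies-id m) B _ 𝒦Glue)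
                                          ℓ S S S<m (λ _ _ → refl) w w-reads-φ
          in-𝒞ᴬ : 𝒞 Flip 𝒦 A ℓ B w
          in-𝒞ᴬ = w-length , realisation⇒glue A ℓ S (copies-S ℓ (<⇒≤ ℓ<N)) B w over-S<m
          in-𝒞 : 𝒞 Flip 𝒦 K (S ℓ) B (λ b → f (w b))
          in-𝒞 = Equivalence.to (proj₂ (proj₂ (f-aged ℓ ℓ<N)) B B-wf w w-length) in-𝒞ᴬ
          over-m+1 : Realised (suc m) id B φ
          over-m+1 = realisation-restrict (S ℓ) id B (λ b → f (w b)) (glue⇒realisation K (S ℓ) id (copies-id (S ℓ)) B _ (proj₂ in-𝒞))
                                          (suc m) id id (λ i i≤m → <-≤-trans i≤m m<Sℓ) (λ _ _ → refl) φ φ-reads-fw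

        push-forward : 𝒞 Flip 𝒦 K (suc m) B φ → 𝒞 Flip 𝒦 K m B (λ b → take m (φ b))
        push-forward (_ , 𝒦Glue) =
          (λ b → restriction-level K s m (φ b) (φ∈ b)) ,
          realisation⇒glue K m id (copies-id m) B _
            (realisation-restrict (suc m) id B φ (glue⇒realisation K (suc m) id (copies-id (suc m)) B φ 𝒦Glue)
                                  m id id (λ i → m≤n⇒m≤1+n) (λ _ _ → refl) (λ b → take m (φ b)) (λ b i → nth-take (φ b) m i))

    cond2 : Cond2 Flip 𝒦 K s
    cond2 m m≤max m∉s =
      restriction-level K s m , restriction-injective K s m cond1 m∉s ,
      λ B B-wf φ φ∈ → mk⇔ (push-forward B B-wf φ φ∈) (pull-back B B-wf φ φ∈)
      where open Restriction m m≤max m∉s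

  -- For t ∈ T(j), f(t) ∈ T(S j) copies t(i) at level S i, and at a level p ∉ S copies R(p, S b)
  -- for any b whose coding node c(S b) lies above p and agrees with t at all levels of S below p
  -- (a "candidate"); by (1) all candidates give the same value; without candidate the entry is 0.
  module Backward (amalgamate : FreeAmalgamation 𝒦) (s : List ℕ) (s-sorted : AllPairs _<_ s)
    (cond1 : Cond1 K s) (cond2 : Cond2 Flip 𝒦 K s) where
    open EnumeratedS s s-sorted

    -- t agrees with the coding node c(S b) at all levels S i < p, which code the entries of t;
    -- b is a candidate for t at p if moreover c(S b) lies above p
    Agrees : Node k → ℕ → ℕ → Set
    Agrees t p b = ∀ i → i < N → S i < p → nth t i ≡ RK (S i) (S b)

    Agrees? : ∀ t p b → Dec (Agrees t p b)
    Agrees? t p b with allUpTo? (λ i → (S i <? p) →-dec (nth t i ≟F RK (S i) (S b))) N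
    ... | yes all = yes λ i i<N → all i<N
    ... | no ¬all = no λ agrees → ¬all λ {i} i<N → agrees i i<N

    Candidate : Node k → ℕ → ℕ → Set
    Candidate t p b = b < N × p < S b × Agrees t p b

    Candidate? : ∀ t p → Dec (∃[ b ] Candidate t p b)
    Candidate? t p = anyUpTo? (λ b → (p <? S b) ×-dec Agrees? t p b) N

    -- (1) makes the choice of candidate irrelevant: if c(S b), c(S b') split below p they split at a
    -- level of S below p, where both agree with t; and p itself is not a level of S.
    candidates-agree : ∀ t p b b' → ¬ InS p → Candidate t p b → Candidate t p b' → RK p (S b) ≡ RK p (S b')
    candidates-agree t p b b' p∉S (b<N , p<Sb , agrees) (b'<N , p<Sb' , agrees') =
      compare (∈⇒index _ (cond1 (S b) (S b') (index⇒∈ b b<N) (index⇒∈ b' b'<N))) (<-cmp p (length (meet u v)))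
      where
      u = code K (S b)
      v = code K (S b')
      compare : InS (length (meet u v)) → Tri (p < length (meet u v)) (p ≡ length (meet u v)) (length (meet u v) < p) →
                RK p (S b) ≡ RK p (S b')
      compare _ (tri< p<q _ _) = trans (sym (nth-code K (S b) p p<Sb)) (trans (meet-agree u v p p<q) (nth-code K (S b') p p<Sb'))
      compare (q' , q'<N , Sq'≡q) (tri≈ _ p≡q _) = ⊥-elim (p∉S (q' , q'<N , trans Sq'≡q (sym p≡q)))
      compare (q' , q'<N , Sq'≡q) (tri> _ _ q<p) = ⊥-elim (meet-split u v q<u q<v same)
        where
        q = length (meet u v)
        q<u : q < length u
        q<u = subst (q <_) (sym (length-code K (S b))) (<-trans q<p p<Sb)
        q<v : q < length v
        q<v = subst (q <_) (sym (length-code K (S b'))) (<-trans q<p p<Sb')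
        Sq'<p : S q' < p
        Sq'<p = subst (_< p) (sym Sq'≡q) q<p
        same : nth u q ≡ nth v q
        same = begin
          nth u q               ≡⟨ cong (nth u) (sym Sq'≡q) ⟩
          nth u (S q')          ≡⟨ nth-code K (S b) (S q') (<-trans Sq'<p p<Sb) ⟩
          RK (S q') (S b)       ≡⟨ sym (agrees q' q'<N Sq'<p) ⟩
          nth t q'              ≡⟨ agrees' q' q'<N Sq'<p ⟩
          RK (S q') (S b')      ≡⟨ sym (nth-code K (S b') (S q') (<-trans Sq'<p p<Sb')) ⟩
          nth v (S q')          ≡⟨ cong (nth v) Sq'≡q ⟩
          nth v q               ∎
          where open ≡-Reasoning

    gap-label : Node k → ℕ → Lab k
    gap-label t p with Candidate? t p
    ... | yes (b , _) = RK p (S b)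
    ... | no _ = fzero

    gap-label-candidate : ∀ t p b → ¬ InS p → Candidate t p b → gap-label t p ≡ RK p (S b)
    gap-label-candidate t p b p∉S cand with Candidate? t p
    ... | yes (b' , cand') = candidates-agree t p b' b p∉S cand' cand
    ... | no none = ⊥-elim (none (b , cand))

    gap-label-none : ∀ t p → ¬ (∃[ b ] Candidate t p b) → gap-label t p ≡ fzero
    gap-label-none t p none with Candidate? t p
    ... | yes cand = ⊥-elim (none cand)
    ... | no _ = refl

    label : Node k → ℕ → Lab k
    label t p with InS? p
    ... | yes (i , _) = nth t i
    ... | no _ = gap-label t p

    label-S : ∀ t i → i < N → label t (S i) ≡ nth t i
    label-S t i i<N with InS? (S i)
    ... | yes (i' , i'<N , e) = cong (nth t) (S-injective i' i i'<N i<N e)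
    ... | no ¬in = ⊥-elim (¬in (i , i<N , refl))

    label-gap : ∀ t p → ¬ InS p → label t p ≡ gap-label t p
    label-gap t p p∉S with InS? p
    ... | yes in-S = ⊥-elim (p∉S in-S)
    ... | no _ = refl

    label-local : ∀ t t' p → (∀ i → i < N → S i ≤ p → nth t i ≡ nth t' i) → label t p ≡ label t' p
    label-local t t' p t≈t' with InS? p
    ... | yes (i , i<N , Si≡p) = t≈t' i i<N (≤-reflexive Si≡p)
    ... | no p∉S with Candidate? t p
    ... | yes (b , b<N , p<Sb , agrees) =
          sym (gap-label-candidate t' p b p∉S (b<N , p<Sb , λ i i<N Si<p → trans (sym (t≈t' i i<N (<⇒≤ Si<p))) (agrees i i<N Si<p)))
    ... | no none =
          sym (gap-label-none t' p λ (b , b<N , p<Sb , agrees) →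
            none (b , b<N , p<Sb , λ i i<N Si<p → trans (t≈t' i i<N (<⇒≤ Si<p)) (agrees i i<N Si<p)))

    f : Node k → Node k
    f t = map (label t) (upTo (S (length t)))

    f-length : ∀ t → length (f t) ≡ S (length t)
    f-length t = length-mapUpTo (label t) (S (length t))

    nth-f : ∀ t p → p < S (length t) → nth (f t) p ≡ label t p
    nth-f t p = nth-mapUpTo (label t) id (S (length t)) p

    f-take : ∀ j t → j ≤ length t → length t < N → f (take j t) ≡ take (S j) (f t)
    f-take j t j≤t t<N = nth-ext _ _ (trans length-f-take (sym (length-take≤ (f t) (S j) Sj≤f))) entries
      where
      j≡ : length (take j t) ≡ j
      j≡ = length-take≤ t j j≤t
      length-f-take : length (f (take j t)) ≡ S j
      length-f-take = trans (f-length (take j t)) (cong S j≡)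
      Sj≤f : S j ≤ length (f t)
      Sj≤f = subst (S j ≤_) (sym (f-length t)) (S-mono≤ j (length t) j≤t t<N)
      entries : ∀ i → i < length (f (take j t)) → nth (f (take j t)) i ≡ nth (take (S j) (f t)) i
      entries i i< = begin
        nth (f (take j t)) i       ≡⟨ nth-f (take j t) i (subst (i <_) (sym (cong S j≡)) i<Sj) ⟩
        label (take j t) i         ≡⟨ label-local (take j t) t i (λ i' i'<N Si'≤i →
                                        nth-take t j i' (S-reflect< i' j i'<N (≤-<-trans j≤t t<N) (≤-<-trans Si'≤i i<Sj))) ⟩
        label t i                  ≡⟨ sym (nth-f t i (<-≤-trans i<Sj (S-mono≤ j (length t) j≤t t<N))) ⟩
        nth (f t) i                ≡⟨ sym (nth-take (f t) (S j) i i<Sj) ⟩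
        nth (take (S j) (f t)) i   ∎
        where
        open ≡-Reasoning
        i<Sj : i < S j
        i<Sj = subst (i <_) length-f-take i<

    -- f(c^{K_S}(j)) = c(S j): at levels of S by definition, elsewhere j itself is a candidate
    f-code : ∀ j → j < N → f (code A j) ≡ code K (S j)
    f-code j j<N = nth-ext _ _ (trans length-f-code (sym (length-code K (S j)))) entries
      where
      length-f-code : length (f (code A j)) ≡ S j
      length-f-code = trans (f-length (code A j)) (cong S (length-code A j))
      label-code : ∀ p → p < S j → Dec (InS p) → label (code A j) p ≡ RK p (S j)
      label-code p p<Sj (yes (i , i<N , refl)) = trans (label-S (code A j) i i<N) (nth-code A j i (S-reflect< i j i<N j<N p<Sj))
      label-code p p<Sj (no p∉S) = trans (label-gap (code A j) p p∉S)
        (gap-label-candidate (code A j) p j p∉S (j<N , p<Sj , λ i i<N Si<p → nth-code A j i (S-reflect< i j i<N j<N (<-trans Si<p p<Sj))))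
      entries : ∀ p → p < length (f (code A j)) → nth (f (code A j)) p ≡ nth (code K (S j)) p
      entries p p< = trans (nth-f (code A j) p (subst (p <_) (f-length (code A j)) p<))
                     (trans (label-code p p<Sj (InS? p)) (sym (nth-code K (S j) p p<Sj)))
        where p<Sj = subst (p <_) length-f-code p<

    -- t is read off f(t) at the levels of S
    f-injective : ∀ x y → length x < N → length y < N → f x ≡ f y → x ≡ y
    f-injective x y x<N y<N fx≡fy = nth-ext x y same-length entries
      where
      same-length : length x ≡ length y
      same-length = S-injective _ _ x<N y<N (trans (sym (f-length x)) (trans (cong length fx≡fy) (f-length y)))
      entries : ∀ i → i < length x → nth x i ≡ nth y i
      entries i i<x = begin
        nth x i             ≡⟨ sym (label-S x i i<N) ⟩
        label x (S i)       ≡⟨ sym (nth-f x (S i) (S-mono i (length x) i<x x<N)) ⟩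
        nth (f x) (S i)     ≡⟨ cong (λ v → nth v (S i)) fx≡fy ⟩
        nth (f y) (S i)     ≡⟨ nth-f y (S i) (S-mono i (length y) (subst (i <_) same-length i<x) y<N) ⟩
        label y (S i)       ≡⟨ label-S y i i<N ⟩
        nth y i             ∎
        where
        open ≡-Reasoning
        i<N = <-trans i<x x<N

    -- f preserves meets: f(x ∧ y) = f(x)|S q for q = ℓ(x ∧ y), and f(x), f(y) agree below S q and
    -- (unless one ends there) differ at S q, where they copy x(q) ≠ y(q)
    f-meet : ∀ x y → length x < N → length y < N → f (meet x y) ≡ meet (f x) (f y)
    f-meet x y x<N y<N = begin
      f (meet x y)               ≡⟨ cong f (meet-is-take x y) ⟩
      f (take q x)               ≡⟨ f-take q x q≤x x<N ⟩
      take (S q) (f x)           ≡⟨ sym (meet-char (f x) (f y) (S q) Sq≤fx Sq≤fy agree-below end) ⟩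
      meet (f x) (f y)           ∎
      where
      open ≡-Reasoning
      q = length (meet x y)
      q≤x = meet-length≤ˡ x y
      q≤y = meet-length≤ʳ x y
      q<N : q < N
      q<N = ≤-<-trans q≤x x<N
      Sq≤fx : S q ≤ length (f x)
      Sq≤fx = subst (S q ≤_) (sym (f-length x)) (S-mono≤ q (length x) q≤x x<N)
      Sq≤fy : S q ≤ length (f y)
      Sq≤fy = subst (S q ≤_) (sym (f-length y)) (S-mono≤ q (length y) q≤y y<N)
      agree-below : ∀ i → i < S q → nth (f x) i ≡ nth (f y) i
      agree-below i i<Sq =
        trans (nth-f x i (<-≤-trans i<Sq (S-mono≤ q (length x) q≤x x<N)))
        (trans (label-local x y i (λ i' i'<N Si'≤i → meet-agree x y i' (S-reflect< i' q i'<N q<N (≤-<-trans Si'≤i i<Sq))))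
        (sym (nth-f y i (<-≤-trans i<Sq (S-mono≤ q (length y) q≤y y<N)))))
      end : MeetEnd (f x) (f y) (S q)
      end with q ≟ length x | q ≟ length y
      ... | yes q≡x | _ = inj₁ (trans (cong S q≡x) (sym (f-length x)))
      ... | no _ | yes q≡y = inj₂ (inj₁ (trans (cong S q≡y) (sym (f-length y))))
      ... | no q≢x | no q≢y = inj₂ (inj₂ λ same → meet-split x y q<x q<y
              (trans (sym (label-S x q q<N)) (trans (sym (nth-f x (S q) (S-mono q (length x) q<x x<N)))
              (trans same (trans (nth-f y (S q) (S-mono q (length y) q<y y<N)) (label-S y q q<N))))))
        where
        q<x = ≤∧≢⇒< q≤x q≢x
        q<y = ≤∧≢⇒< q≤y q≢y

    -- f(x⌢a) ⊒ f(x)⌢a: f(x⌢a) extends f(x) and copies a at level S(ℓ(x))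
    f-extends : ∀ x a → length (x ++ [ a ]) < N → (f x ++ [ a ]) ⊑ f (x ++ [ a ])
    f-extends x a xa<N = drop (suc (S j)) v , trans (cong (_++ drop (suc (S j)) v) (sym prefix)) (take++drop≡id (suc (S j)) v)
      where
      j = length x
      v = f (x ++ [ a ])
      xa≡ : length (x ++ [ a ]) ≡ suc j
      xa≡ = length-snoc x a
      j+1<N : suc j < N
      j+1<N = subst (_< N) xa≡ xa<N
      j<N : j < N
      j<N = <-trans (n<1+n j) j+1<N
      Sj<Sj+1 : S j < S (suc j)
      Sj<Sj+1 = S-mono j (suc j) ≤-refl j+1<N
      v-length : length (take (suc (S j)) v) ≡ suc (S j)
      v-length = length-take≤ v (suc (S j)) (subst (suc (S j) ≤_) (sym (trans (f-length (x ++ [ a ])) (cong S xa≡))) Sj<Sj+1)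
      entry : ∀ i → i < suc (S j) → nth (take (suc (S j)) v) i ≡ nth (f x ++ [ a ]) i
      entry i i≤Sj with m<1+n⇒m<n∨m≡n i≤Sj
      ... | inj₁ i<Sj = begin
        nth (take (suc (S j)) v) i   ≡⟨ nth-take v (suc (S j)) i i≤Sj ⟩
        nth v i                      ≡⟨ nth-f (x ++ [ a ]) i (subst (i <_) (sym (cong S xa≡)) (<-trans i<Sj Sj<Sj+1)) ⟩
        label (x ++ [ a ]) i         ≡⟨ label-local (x ++ [ a ]) x i (λ i' i'<N Si'≤i →
                                          nth-++ˡ x [ a ] i' (S-reflect< i' j i'<N j<N (≤-<-trans Si'≤i i<Sj))) ⟩
        label x i                    ≡⟨ sym (nth-f x i i<Sj) ⟩
        nth (f x) i                  ≡⟨ sym (nth-++ˡ (f x) [ a ] i (subst (i <_) (sym (f-length x)) i<Sj)) ⟩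
        nth (f x ++ [ a ]) i         ∎
        where open ≡-Reasoning
      ... | inj₂ refl = begin
        nth (take (suc (S j)) v) (S j)   ≡⟨ nth-take v (suc (S j)) (S j) ≤-refl ⟩
        nth v (S j)                      ≡⟨ nth-f (x ++ [ a ]) (S j) (subst (S j <_) (sym (cong S xa≡)) Sj<Sj+1) ⟩
        label (x ++ [ a ]) (S j)         ≡⟨ label-S (x ++ [ a ]) j j<N ⟩
        nth (x ++ [ a ]) j               ≡⟨ nth-snoc x a ⟩
        a                                ≡⟨ sym (nth-snoc (f x) a) ⟩
        nth (f x ++ [ a ]) (length (f x)) ≡⟨ cong (nth (f x ++ [ a ])) (f-length x) ⟩
        nth (f x ++ [ a ]) (S j)         ∎
        where open ≡-Reasoning
      prefix : take (suc (S j)) v ≡ f x ++ [ a ]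
      prefix = nth-ext _ _ (trans v-length (sym (trans (length-snoc (f x) a) (cong suc (f-length x)))))
                           (λ i i< → entry i (subst (i <_) v-length i<))

    f-copied-or-0 : ∀ t p → ¬ InS p → p < S (length t) → CopiedOr0 (CSrestr K s p) p (f t)
    f-copied-or-0 t p p∉S p<ft with Candidate? t p
    ... | no none = inj₂ (trans (nth-f t p p<ft) (trans (label-gap t p p∉S) (gap-label-none t p none)))
    ... | yes (b , b<N , p<Sb , agrees) = inj₁ (take (suc p) (code K (S b)) , (S b , index⇒∈ b b<N , p<Sb , refl) , agree)
      where
      label-candidate : ∀ i → i ≤ p → Dec (InS i) → label t i ≡ RK i (S b)
      label-candidate i i≤p (yes (i' , i'<N , refl)) =
        trans (label-S t i' i'<N) (agrees i' i'<N (≤∧≢⇒< i≤p λ Si'≡p → p∉S (i' , i'<N , Si'≡p)))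
      label-candidate i i≤p (no i∉S) = trans (label-gap t i i∉S)
        (gap-label-candidate t i b i∉S (b<N , ≤-<-trans i≤p p<Sb , λ i' i'<N Si'<i → agrees i' i'<N (<-≤-trans Si'<i i≤p)))
      agree : ∀ i → i ≤ p → nth (f t) i ≡ nth (take (suc p) (code K (S b))) i
      agree i i≤p = trans (nth-f t i (≤-<-trans i≤p p<ft)) (trans (label-candidate i i≤p (InS? i))
                    (sym (trans (nth-take (code K (S b)) (suc p) i (s≤s i≤p)) (nth-code K (S b) i (≤-<-trans i≤p p<Sb)))))

    GapLevel : (B : FinStr k) → (Fin (size B) → Node k) → ℕ → Set
    GapLevel B G p = ¬ InS p × (∃[ a ] (a ∈ s × p ≤ a)) × (∀ b → CopiedOr0 (CSrestr K s p) p (G b))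

    gap-level : ∀ (B : FinStr k) (ψ : Fin (size B) → Node k) j → j < N → (∀ b → length (ψ b) ≡ j) →
                ∀ p → p < S j → ¬ InS p → GapLevel B (λ b → f (ψ b)) p
    gap-level B ψ j j<N ψ-length p p<Sj p∉S =
      p∉S , (S j , index⇒∈ j j<N , <⇒≤ p<Sj) , λ b → f-copied-or-0 (ψ b) p p∉S (subst (λ z → p < S z) (sym (ψ-length b)) p<Sj)

    aged-at-gap : ∀ p → ¬ InS p → (∃[ a ] (a ∈ s × p ≤ a)) →
                  ∀ (B' : FinStr k) → WF Flip B' → (φ' : Fin (size B') → Node k) →
                  (∀ b → CSrestr K s p (φ' b)) → 𝒦 (Glue Flip p K B' (λ b → take p (φ' b))) → 𝒦 (Glue Flip (suc p) K B' φ')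
    aged-at-gap p p∉S p≤max B' B'-wf φ' φ'∈ 𝒦Glue =
      proj₂ (Equivalence.from (proj₂ (proj₂ aged) B' B'-wf φ' φ'∈) ((λ b → proj₁ aged (φ' b) (φ'∈ b)) , 𝒦Glue))
      where aged = cond2 p p≤max (¬InS⇒∉S p p∉S)

    across-gap : ∀ d a (B : FinStr k) → WF Flip B → (G : Fin (size B) → Node k) →
                 (∀ p → a ≤ p → p < a + d → GapLevel B G p) → Realised a id B G ⇔ Realised (a + d) id B G
    across-gap zero a B B-wf G _ = subst (λ z → Realised a id B G ⇔ Realised z id B G) (sym (+-identityʳ a)) ⇔-refl
    across-gap (suc d) a B B-wf G gaps =
      ⇔-trans (across-gap d a B B-wf G (λ p a≤p p< → gaps p a≤p (<-≤-trans p< (+-monoʳ-≤ a (n≤1+n d)))))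
              (subst (λ z → Realised (a + d) id B G ⇔ Realised z id B G) (sym (+-suc a d)) one-step)
      where
      gap = gaps (a + d) (m≤m+n a d) (subst (a + d <_) (sym (+-suc a d)) ≤-refl)
      one-step : Realised (a + d) id B G ⇔ Realised (suc (a + d)) id B G
      one-step = mk⇔
        (AmalgamationStep.realisation-step amalgamate (a + d) (CSrestr K s (a + d))
          (aged-at-gap (a + d) (proj₁ gap) (proj₁ (proj₂ gap))) B B-wf G (proj₂ (proj₂ gap)))
        (λ r → realisation-restrict (suc (a + d)) id B G r (a + d) id id (λ i → m≤n⇒m≤1+n) (λ _ _ → refl) G (λ _ _ _ → refl))

    -- The level-j step of the induction below: with B⁺ = B plus a copy of the point S j,
    --   Realised (j+1) S B ψ ⇔ Realised j S B⁺ ψ⁺                      (absorb the point S j)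
    --   Realised (S j) id B⁺ (f ∘ ψ⁺) ⇔ Realised (S j) id B⁺ fψ⁺      (f(c^{K_S}(j)) = c(S j))
    --   Realised (S j) id B⁺ fψ⁺ ⇔ Realised (S j + 1) id B (f ∘ ψ)     (emit the point S j)
    --   Realised (S j + 1) id B (f ∘ ψ) ⇔ Realised (S (j+1)) id B (f ∘ ψ)   (across the gap)
    module LevelStep (j : ℕ) (j+1<N : suc j < N) (B : FinStr k) (B-wf : WF Flip B) (ψ : Fin (size B) → Node k)
                     (ψ-length : ∀ b → length (ψ b) ≡ suc j) where

      j<N : j < N
      j<N = <-trans (n<1+n j) j+1<N

      Sj<Sj+1 : S j < S (suc j)
      Sj<Sj+1 = S-mono j (suc j) ≤-refl j+1<N

      j≤ψ : ∀ b → j ≤ length (ψ b)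
      j≤ψ b = subst (j ≤_) (sym (ψ-length b)) (n≤1+n j)

      ρ : Fin (size B) → Lab k
      ρ b = nth (ψ b) j

      B⁺ : FinStr k
      B⁺ = B ⊕⟨ UK (S j) , ρ ⟩

      ψ⁺ : Fin (suc (size B)) → Node k
      ψ⁺ = label⊕ (code A j) (λ b → take j (ψ b))

      ψ⁺-length : ∀ a → length (ψ⁺ a) ≡ j
      ψ⁺-length fzero = length-code A j
      ψ⁺-length (fsuc b) = length-take≤ (ψ b) j (j≤ψ b)

      fψ⁺ : Fin (suc (size B)) → Node k
      fψ⁺ = label⊕ (code K (S j)) (λ b → f (take j (ψ b)))

      absorb : Realised (suc j) S B ψ ⇔ Realised j S B⁺ ψ⁺
      absorb = mk⇔
        (realisation-absorb j S B ψ (UK (S j)) ρ (code A j) (λ b → take j (ψ b)) (λ _ → refl) refl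
           (nth-code A j) (λ b → nth-take (ψ b) j) (λ i i<j → <⇒≢ (S-mono i j i<j j<N)))
        (realisation-emit j S B ψ (UK (S j)) ρ (code A j) (λ b → take j (ψ b)) (λ _ → refl) refl
           (nth-code A j) (λ b → nth-take (ψ b) j)
           (λ i i' i< i'< → S-injective i i' (<-≤-trans i< (<⇒≤ j+1<N)) (<-≤-trans i'< (<⇒≤ j+1<N))))

      recode : Realised (S j) id B⁺ (λ a → f (ψ⁺ a)) ⇔ Realised (S j) id B⁺ fψ⁺
      recode = mk⇔ (realisation-relabel (S j) id B⁺ (λ a → f (ψ⁺ a)) fψ⁺ (λ a i _ → sym (same a i)))
                   (realisation-relabel (S j) id B⁺ fψ⁺ (λ a → f (ψ⁺ a)) (λ a i _ → same a i))
        where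
        same : ∀ a i → nth (f (ψ⁺ a)) i ≡ nth (fψ⁺ a) i
        same fzero i = cong (λ z → nth z i) (f-code j j<N)
        same (fsuc b) i = refl

      ρ≡ : ∀ b → ρ b ≡ nth (f (ψ b)) (S j)
      ρ≡ b = sym (trans (nth-f (ψ b) (S j) (subst (λ z → S j < S z) (sym (ψ-length b)) Sj<Sj+1)) (label-S (ψ b) j j<N))

      f-take-j : ∀ b i → i < S j → nth (f (take j (ψ b))) i ≡ nth (f (ψ b)) i
      f-take-j b i i<Sj = trans (cong (λ z → nth z i) (f-take j (ψ b) (j≤ψ b) (subst (_< N) (sym (ψ-length b)) j+1<N)))
                                (nth-take (f (ψ b)) (S j) i i<Sj)

      emit : Realised (S j) id B⁺ fψ⁺ ⇔ Realised (suc (S j)) id B (λ b → f (ψ b))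
      emit = mk⇔
        (realisation-emit (S j) id B (λ b → f (ψ b)) (UK (S j)) ρ (code K (S j)) (λ b → f (take j (ψ b))) ρ≡ refl
           (nth-code K (S j)) f-take-j (λ _ _ _ _ e → e))
        (realisation-absorb (S j) id B (λ b → f (ψ b)) (UK (S j)) ρ (code K (S j)) (λ b → f (take j (ψ b))) ρ≡ refl
           (nth-code K (S j)) f-take-j (λ i i<Sj → <⇒≢ i<Sj))

      -- the levels strictly between S j and S (j+1) are not in S
      cross : Realised (suc (S j)) id B (λ b → f (ψ b)) ⇔ Realised (S (suc j)) id B (λ b → f (ψ b))
      cross = subst (λ z → Realised (suc (S j)) id B (λ b → f (ψ b)) ⇔ Realised z id B (λ b → f (ψ b))) d≡
                (across-gap d (suc (S j)) B B-wf (λ b → f (ψ b)) gaps)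
        where
        d = S (suc j) ∸ suc (S j)
        d≡ : suc (S j) + d ≡ S (suc j)
        d≡ = m+[n∸m]≡n Sj<Sj+1
        gaps : ∀ p → suc (S j) ≤ p → p < suc (S j) + d → GapLevel B (λ b → f (ψ b)) p
        gaps p Sj<p p<d = gap-level B ψ (suc j) j+1<N ψ-length p p<Sj+1 λ (i , i<N , Si≡p) →
            <-irrefl refl (<-≤-trans (S-reflect< j i j<N i<N (subst (S j <_) (sym Si≡p) Sj<p))
                                     (≤-pred (S-reflect< i (suc j) i<N j+1<N (subst (_< S (suc j)) (sym Si≡p) p<Sj+1))))
          where
          p<Sj+1 : p < S (suc j)
          p<Sj+1 = subst (p <_) d≡ p<d

    level-equivalence : ∀ j → j < N → ∀ (B : FinStr k) → WF Flip B → ∀ (ψ : Fin (size B) → Node k) →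
                        (∀ b → length (ψ b) ≡ j) → Realised j S B ψ ⇔ Realised (S j) id B (λ b → f (ψ b))
    level-equivalence zero 0<N B B-wf ψ ψ-length =
      ⇔-trans (mk⇔ (λ r → realisation-restrict 0 S B ψ r 0 id id (λ _ ()) (λ _ ()) (λ b → f (ψ b)) (λ _ _ ()))
                   (λ r → realisation-restrict 0 id B (λ b → f (ψ b)) r 0 S id (λ _ ()) (λ _ ()) ψ (λ _ _ ())))
              (across-gap (S 0) 0 B B-wf (λ b → f (ψ b)) λ p _ p<S0 →
                gap-level B ψ 0 0<N ψ-length p p<S0 λ (i , i<N , Si≡p) → n≮0 (S-reflect< i 0 i<N 0<N (subst (_< S 0) (sym Si≡p) p<S0)))
    level-equivalence (suc j) j+1<N B B-wf ψ ψ-length =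
      ⇔-trans absorb (⇔-trans (level-equivalence j j<N B⁺ (⊕-wf B (UK (S j)) ρ B-wf) ψ⁺ ψ⁺-length)
                     (⇔-trans recode (⇔-trans emit cross)))
      where open LevelStep j j+1<N B B-wf ψ ψ-length

    f-aged : ∀ j → j < N → AgeMap Flip (Lev j) (Lev (S j)) (𝒞 Flip 𝒦 A j) (𝒞 Flip 𝒦 K (S j)) f
    f-aged j j<N = (λ x x-length → trans (f-length x) (cong S x-length)) ,
                   (λ x y x-length y-length → f-injective x y (subst (_< N) (sym x-length) j<N) (subst (_< N) (sym y-length) j<N)) ,
                   classes
      where
      classes : ∀ (B : FinStr k) → WF Flip B → (ψ : Fin (size B) → Node k) → (∀ b → Lev j (ψ b)) →
                𝒞 Flip 𝒦 A j B ψ ⇔ 𝒞 Flip 𝒦 K (S j) B (λ b → f (ψ b))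
      classes B B-wf ψ ψ-length =
        mk⇔ (λ (_ , 𝒦G) → (λ b → trans (f-length (ψ b)) (cong S (ψ-length b))) , Equivalence.to glue-chain 𝒦G)
            (λ (_ , 𝒦G) → ψ-length , Equivalence.from glue-chain 𝒦G)
        where
        glue-chain : 𝒦 (Glue Flip j A B ψ) ⇔ 𝒦 (Glue Flip (S j) K B (λ b → f (ψ b)))
        glue-chain = ⇔-trans (glue⇔realisation A j S (copies-S j (<⇒≤ j<N)) B ψ)
                     (⇔-trans (level-equivalence j j<N B B-wf ψ ψ-length)
                              (⇔-sym (glue⇔realisation K (S j) id (copies-id (S j)) B (λ b → f (ψ b)))))

    envelope : Envelope Flip 𝒦 K s
    envelope = f , f-injective , (λ j x _ x-length → trans (f-length x) (cong S x-length)) , f-meet , f-extends ,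
               (λ j j<N → f-code j j<N , refl) , f-aged

-- the statement is phrased with Fin's zero (the label 0); it overloads ℕ's zero from here on
open import Data.Fin using (zero)

proposition4p2 : ∀ {k : ℕ} (Flip : Lab k → Lab k) → Flip zero ≡ zero → (∀ i → Flip (Flip i) ≡ i) →
    (𝒦 : FinStr k → Set) (K : EnumStr k) →
    WFω Flip K →
    (∀ A → 𝒦 A ⇔ Age K A) →
    FreeAmalgamation 𝒦 →
    Ultrahomogeneous K →
    LeftDense 𝒦 K →
    (s : List ℕ) → AllPairs _<_ s →
    Envelope Flip 𝒦 K s ⇔ (Cond1 K s × Cond2 Flip 𝒦 K s)
proposition4p2 Flip flip0 flip-involutive 𝒦 K K-wf 𝒦≡Age amalgamate K-uh _ s s-sorted =
  mk⇔ (λ (f , f-aemb) → Forward.cond1 s s-sorted f f-aemb , Forward.cond2 s s-sorted f f-aemb)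
      (λ (cond1 , cond2) → Backward.envelope amalgamate s s-sorted cond1 cond2)
  where open Envelopes Flip flip0 flip-involutive 𝒦 K K-wf 𝒦≡Age K-uh
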